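{- For every integer $n\ge 0$ there is a bijection between $\mathcal{D}^{\mathfrak{F}}(n)$ and the set $\mathcal{LS}(n)$ of Little Schröder paths of length $2n$. The cardinality of both sets is the $n$-th Little Schröder number.
   Context: A Dyck path of length $2n$ is a word in the letters $U,D$ with $n$ letters of each kind such that every prefix contains at least as many $U$'s as $D$'s. A $k$-ascent of a Dyck path is a maximal block of $k$ consecutive letters $U$. $\mathcal{F}(k)$ denotes the set of Dyck paths of length $2k$ that are concatenations of pyramids $U^{j}D^{j}$ ($j\ge1$) of arbitrary sizes ($\mathcal{F}(0)$ contains only the empty path; $|\mathcal{F}(k)|=2^{k-1}$ for $k\ge1$). $\mathcal{D}^{\mathfrak{F}}(n)$ is the set of Dyck paths $P$ of length $2n$ together with an assignment, to each ascent of $P$ of length $k$, of an element of $\mathcal{F}(k)$. A Little Schröder path of length $2n$ is a lattice path from $(0,0)$ to $(2n,0)$ with steps $U=(1,1)$, $D=(1,-1)$, $L=(2,0)$ that never goes below the $x$-axis and has no $L$-step on the $x$-axis. The Little Schröder numbers $1,1,3,11,45,197,\dots$ (OEIS A001003) are $s_0=1$ and, for $n\ge1$, $s_n$ = the number of dissections of a labeled convex $(n+2)$-gon by non-crossing diagonals. -}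

module Defs where

open import Data.Bool using (Bool; true; false; _∧_; _∨_; not; T; if_then_else_)
open import Data.Nat using (ℕ; zero; suc; _+_; _*_; _≡ᵇ_; _<ᵇ_)
open import Data.List using (List; []; _∷_; length; filter; map; _++_)
open import Data.List.Relation.Unary.All using (All)
open import Data.Product using (Σ; _×_; _,_)
open import Data.Maybe using (Maybe; just; nothing)

data UD : Set where
  U D : UD

dyckFrom : ℕ → List UD → Bool
dyckFrom zero    []       = true
dyckFrom (suc _) []       = false
dyckFrom h       (U ∷ w)  = dyckFrom (suc h) w
dyckFrom zero    (D ∷ w)  = false
dyckFrom (suc h) (D ∷ w)  = dyckFrom h w

isDyck : ℕ → List UD → Bool
isDyck n w = (length w ≡ᵇ (2 * n)) ∧ dyckFrom 0 w

DyckPath : ℕ → Set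
DyckPath n = Σ (List UD) (λ w → T (isDyck n w))

ascentsGo : ℕ → List UD → List ℕ
ascentsGo zero    []      = []
ascentsGo (suc k) []      = suc k ∷ []
ascentsGo c       (U ∷ w) = ascentsGo (suc c) w
ascentsGo zero    (D ∷ w) = ascentsGo zero w
ascentsGo (suc k) (D ∷ w) = suc k ∷ ascentsGo zero w

ascents : List UD → List ℕ
ascents = ascentsGo zero

leadingU : List UD → ℕ × List UD
leadingU (U ∷ w) with leadingU w
... | (j , r) = (suc j , r)
leadingU w = (zero , w)

dropDs : ℕ → List UD → Maybe (List UD)
dropDs zero    w       = just w
dropDs (suc j) (D ∷ w) = dropDs j w
dropDs (suc j) _       = nothing

-- is w a (possibly empty) concatenation of pyramids? (fuel = length w suffices)
pyramidsFuel : ℕ → List UD → Bool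
pyramidsFuel _        []        = true
pyramidsFuel zero     (_ ∷ _)   = false
pyramidsFuel (suc f)  w@(_ ∷ _) with leadingU w
... | (zero , _) = false
... | (suc j , r) with dropDs (suc j) r
...   | nothing = false
...   | just r' = pyramidsFuel f r'

isPyramids : List UD → Bool
isPyramids w = pyramidsFuel (length w) w

𝓕 : ℕ → Set
𝓕 k = Σ (List UD) (λ w → T (isDyck k w ∧ isPyramids w))

DF : ℕ → Set
DF n = Σ (DyckPath n) (λ P → All 𝓕 (ascents (Σ.proj₁ P)))
  where open Σ

data UDL : Set where
  sU sD sL : UDL

width : List UDL → ℕ
width []      = 0
width (sU ∷ w) = suc (width w)
width (sD ∷ w) = suc (width w)
width (sL ∷ w) = 2 + width w

schFrom : ℕ → List UDL → Bool
schFrom zero    []      = true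
schFrom (suc _) []      = false
schFrom h       (sU ∷ w) = schFrom (suc h) w
schFrom zero    (sD ∷ w) = false
schFrom (suc h) (sD ∷ w) = schFrom h w
schFrom zero    (sL ∷ w) = false
schFrom (suc h) (sL ∷ w) = schFrom (suc h) w

isLittleSchroder : ℕ → List UDL → Bool
isLittleSchroder n w = (width w ≡ᵇ (2 * n)) ∧ schFrom 0 w

LS : ℕ → Set
LS n = Σ (List UDL) (λ w → T (isLittleSchroder n w))

-- Little Schröder numbers: number of dissections of a labelled convex
-- (n+2)-gon (vertices 0,1,…,n+1 in cyclic order) by non-crossing diagonals.

range : ℕ → List ℕ
range zero    = []
range (suc m) = range m ++ (m ∷ [])

isDiagonal : ℕ → ℕ × ℕ → Bool
isDiagonal n (i , j) = ((suc i) <ᵇ j) ∧ not ((i ≡ᵇ 0) ∧ (j ≡ᵇ suc n))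

concatMap' : {A B : Set} → (A → List B) → List A → List B
concatMap' f []       = []
concatMap' f (x ∷ xs) = f x ++ concatMap' f xs

diagonals : ℕ → List (ℕ × ℕ)
diagonals n = filter (λ p → T? (isDiagonal n p))
  (concatMap' (λ i → map (λ j → (i , j)) (range (2 + n))) (range (2 + n)))
  where
  open import Relation.Nullary.Decidable using (Dec)
  open import Data.Bool.Properties using (T?)

powerset : {A : Set} → List A → List (List A)
powerset []       = [] ∷ []
powerset (x ∷ xs) = let ps = powerset xs in ps ++ map (x ∷_) ps

crosses : ℕ × ℕ → ℕ × ℕ → Bool
crosses (a , b) (c , d) =
  ((a <ᵇ c) ∧ (c <ᵇ b) ∧ (b <ᵇ d)) ∨ ((c <ᵇ a) ∧ (a <ᵇ d) ∧ (d <ᵇ b))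

allB : {A : Set} → (A → Bool) → List A → Bool
allB p []       = true
allB p (x ∷ xs) = p x ∧ allB p xs

nonCrossing : List (ℕ × ℕ) → Bool
nonCrossing s = allB (λ x → allB (λ y → not (crosses x y)) s) s

dissections : ℕ → List (List (ℕ × ℕ))
dissections n = filter (λ s → T? (nonCrossing s)) (powerset (diagonals n))
  where open import Data.Bool.Properties using (T?)

littleSchroder : ℕ → ℕ
littleSchroder n = length (dissections n)

-- Both sets are counted by their first steps, tracking the height (and, for
-- D^F, the length of the current ascent), which puts them in bijection with
-- Fin of explicit counts indexed by the width w = 2n. Decorating an ascent of
-- length k by one of the 2^(k-1) pyramid sequences amounts to weighting every
-- U that continues an ascent by 2; a first-descent decomposition shows that
-- these weighted Dyck paths satisfy the same convolution recurrences as the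
-- Schröder paths, little(w + 2) = Σ large(i) little(w - i) and
-- large + [w = 0] = 2 little. Dissections, classified by the first diagonal
-- from vertex 0 that they use, obey d(n + 1) = Σ c(t + 1) d(n - t), where c
-- counts non-crossing chord sets that may also use one side of the polygon,
-- so c(t + 1) + [t = 0] = 2 d(t). Since odd widths contribute nothing,
-- induction gives d(n) = little(2n).

module Submission where

open import Defs
open import Data.Nat using (ℕ)
open import Data.Fin using (Fin)
open import Data.Product using (_×_)
open import Function.Bundles using (_↔_)

open import Data.Bool using (Bool; true; false; _∧_; _∨_; not; T; if_then_else_)
open import Data.Bool.Properties using (T?; T-≡; T-∧; T-irrelevant; ⇔→≡; ∨-comm; ∧-identityʳ; not-involutive)
open import Data.Empty using (⊥; ⊥-elim)
open import Data.Fin.Properties using (+↔⊎; *↔×; 0↔⊥; 1↔⊤)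
open import Data.List using (List; []; _∷_; [_]; length; map; _++_; filter)
open import Data.List.Properties using (map-++; map-∘; ++-assoc; ++-identityʳ; filter-++; filter-all; filter-none)
open import Data.List.Membership.Propositional using (_∈_)
open import Data.List.Membership.Propositional.Properties using (∈-++⁺ˡ; ∈-++⁺ʳ; ∈-++⁻; ∈-map⁻)
open import Data.List.Relation.Binary.Permutation.Propositional using (_↭_; ↭-sym; ↭-trans)
open import Data.List.Relation.Binary.Permutation.Propositional.Properties
  using (∈-resp-↭; shift; shifts; ++⁺ˡ) renaming (++-identityʳ to ↭-++-identityʳ)
open import Data.List.Relation.Binary.Subset.Propositional using (_⊆_)
open import Data.List.Relation.Unary.All using (All; []; _∷_; tabulate)
open import Data.List.Relation.Unary.Any using (here; there)
open import Data.Maybe using (just; nothing)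
open import Data.Nat
open import Data.Nat.Induction using (<-rec)
open import Data.Nat.Properties
open import Algebra.Properties.CommutativeSemigroup *-commutativeSemigroup using (x∙yz≈y∙xz)
open import Algebra.Properties.CommutativeSemigroup +-commutativeSemigroup using () renaming (interchange to +-interchange)
open import Data.Nat.Tactic.RingSolver using (solve-∀)
open import Data.Product using (Σ; _,_; proj₁; proj₂)
open import Data.Product.Function.NonDependent.Propositional using (_×-↔_)
open import Data.Sum using (_⊎_; inj₁; inj₂)
open import Data.Sum.Function.Propositional using (_⊎-↔_)
open import Data.Unit using (⊤; tt)
open import Function using (_∘_)
open import Function.Bundles using (mk↔ₛ′; mk⇔; Equivalence)
open import Function.Properties.Inverse using (↔-refl; ↔-sym; ↔-trans)
open import Relation.Binary.PropositionalEquality hiding ([_])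
open import Relation.Nullary using (¬_)
open import Relation.Unary using (Decidable)
open ≡-Reasoning

-- Convolution of sequences

-- conv f g n = Σ_{i ≤ n} f i * g (n ∸ i)
conv : (ℕ → ℕ) → (ℕ → ℕ) → ℕ → ℕ
conv f g zero    = f 0 * g 0
conv f g (suc n) = f 0 * g (suc n) + conv (f ∘ suc) g n

conv-cong : ∀ {f f′ g g′} n → (∀ i → i ≤ n → f i ≡ f′ i) → (∀ i → i ≤ n → g i ≡ g′ i) →
            conv f g n ≡ conv f′ g′ n
conv-cong zero    f≗ g≗ = cong₂ _*_ (f≗ 0 z≤n) (g≗ 0 z≤n)
conv-cong (suc n) f≗ g≗ =
  cong₂ _+_ (cong₂ _*_ (f≗ 0 z≤n) (g≗ (suc n) ≤-refl))
            (conv-cong n (λ i i≤n → f≗ (suc i) (s≤s i≤n)) (λ i i≤n → g≗ i (m≤n⇒m≤1+n i≤n)))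

conv-distribʳ-+ : ∀ f g h n → conv (λ i → f i + g i) h n ≡ conv f h n + conv g h n
conv-distribʳ-+ f g h zero    = *-distribʳ-+ (h 0) (f 0) (g 0)
conv-distribʳ-+ f g h (suc n)
  rewrite conv-distribʳ-+ (f ∘ suc) (g ∘ suc) h n | *-distribʳ-+ (h (suc n)) (f 0) (g 0) =
  +-interchange (f 0 * h (suc n)) (g 0 * h (suc n)) (conv (f ∘ suc) h n) (conv (g ∘ suc) h n)

conv-distribˡ-+ : ∀ f g h n → conv f (λ i → g i + h i) n ≡ conv f g n + conv f h n
conv-distribˡ-+ f g h zero    = *-distribˡ-+ (f 0) (g 0) (h 0)
conv-distribˡ-+ f g h (suc n)
  rewrite conv-distribˡ-+ (f ∘ suc) g h n | *-distribˡ-+ (f 0) (g (suc n)) (h (suc n)) =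
  +-interchange (f 0 * g (suc n)) (f 0 * h (suc n)) (conv (f ∘ suc) g n) (conv (f ∘ suc) h n)

conv-scaleˡ : ∀ c f h n → conv (λ i → c * f i) h n ≡ c * conv f h n
conv-scaleˡ c f h zero    = *-assoc c (f 0) (h 0)
conv-scaleˡ c f h (suc n) rewrite conv-scaleˡ c (f ∘ suc) h n | *-assoc c (f 0) (h (suc n)) =
  sym (*-distribˡ-+ c (f 0 * h (suc n)) (conv (f ∘ suc) h n))

conv-scaleʳ : ∀ c f h n → conv f (λ i → c * h i) n ≡ c * conv f h n
conv-scaleʳ c f h zero    = x∙yz≈y∙xz (f 0) c (h 0)
conv-scaleʳ c f h (suc n) rewrite conv-scaleʳ c (f ∘ suc) h n =
  trans (cong (_+ c * conv (f ∘ suc) h n) (x∙yz≈y∙xz (f 0) c (h (suc n))))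
        (sym (*-distribˡ-+ c (f 0 * h (suc n)) (conv (f ∘ suc) h n)))

conv-sucʳ : ∀ f g n → conv f g (suc n) ≡ conv f (g ∘ suc) n + f (suc n) * g 0
conv-sucʳ f g zero    = refl
conv-sucʳ f g (suc n) rewrite conv-sucʳ (f ∘ suc) g n =
  sym (+-assoc (f 0 * g (suc (suc n))) (conv (f ∘ suc) (g ∘ suc) n) (f (suc (suc n)) * g 0))

conv-assoc : ∀ f g h n → conv (conv f g) h n ≡ conv f (conv g h) n
conv-assoc f g h zero    = *-assoc (f 0) (g 0) (h 0)
conv-assoc f g h (suc n) = begin
  conv f g 0 * h (suc n) + conv (conv f g ∘ suc) h n
    ≡⟨ cong (conv f g 0 * h (suc n) +_) (conv-distribʳ-+ (λ m → f 0 * g (suc m)) (conv (f ∘ suc) g) h n) ⟩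
  conv f g 0 * h (suc n) + (conv (λ m → f 0 * g (suc m)) h n + conv (conv (f ∘ suc) g) h n)
    ≡⟨ cong₂ (λ a b → conv f g 0 * h (suc n) + (a + b)) (conv-scaleˡ (f 0) (g ∘ suc) h n) (conv-assoc (f ∘ suc) g h n) ⟩
  f 0 * g 0 * h (suc n) + (f 0 * conv (g ∘ suc) h n + conv (f ∘ suc) (conv g h) n)
    ≡⟨ regroup (f 0) (g 0) (h (suc n)) (conv (g ∘ suc) h n) (conv (f ∘ suc) (conv g h) n) ⟩
  f 0 * (g 0 * h (suc n) + conv (g ∘ suc) h n) + conv (f ∘ suc) (conv g h) n ∎
  where
  regroup : ∀ a b c d e → a * b * c + (a * d + e) ≡ a * (b * c + d) + e
  regroup = solve-∀

conv-sucʳ-zero : ∀ f g n → g 0 ≡ 0 → conv f g (suc n) ≡ conv f (g ∘ suc) n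
conv-sucʳ-zero f g n g0≡0 = begin
  conv f g (suc n)                     ≡⟨ conv-sucʳ f g n ⟩
  conv f (g ∘ suc) n + f (suc n) * g 0 ≡⟨ cong (λ x → conv f (g ∘ suc) n + f (suc n) * x) g0≡0 ⟩
  conv f (g ∘ suc) n + f (suc n) * 0   ≡⟨ cong (conv f (g ∘ suc) n +_) (*-zeroʳ (f (suc n))) ⟩
  conv f (g ∘ suc) n + 0               ≡⟨ +-identityʳ _ ⟩
  conv f (g ∘ suc) n ∎

ε : ℕ → ℕ
ε zero    = 1
ε (suc _) = 0

conv-identityʳ : ∀ f n → conv f ε n ≡ f n
conv-identityʳ f zero    = *-identityʳ (f 0)
conv-identityʳ f (suc n) = begin
  conv f ε (suc n)                   ≡⟨ conv-sucʳ f ε n ⟩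
  conv f (ε ∘ suc) n + f (suc n) * 1 ≡⟨ cong₂ _+_ (conv-zeroʳ f n) (*-identityʳ (f (suc n))) ⟩
  f (suc n) ∎
  where
  conv-zeroʳ : ∀ f n → conv f (ε ∘ suc) n ≡ 0
  conv-zeroʳ f zero    = *-zeroʳ (f 0)
  conv-zeroʳ f (suc n) rewrite *-zeroʳ (f 0) = conv-zeroʳ (f ∘ suc) n

-- Schröder paths counted by width

-- Paths from height h of width w that stay weakly above the axis and end on it;
-- the flag says whether L-steps are allowed on the axis.
schröderFrom : Bool → ℕ → ℕ → ℕ
schröderFrom l zero    zero          = 1
schröderFrom l (suc h) zero          = 0
schröderFrom l zero    (suc zero)    = schröderFrom l 1 0
schröderFrom l zero    (suc (suc w)) = schröderFrom l 1 (suc w) + (if l then schröderFrom l 0 w else 0)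
schröderFrom l (suc h) (suc zero)    = schröderFrom l (suc (suc h)) 0 + schröderFrom l h 0
schröderFrom l (suc h) (suc (suc w)) =
  schröderFrom l (suc (suc h)) (suc w) + schröderFrom l h (suc w) + schröderFrom l (suc h) w

large little : ℕ → ℕ
large  = schröderFrom true 0
little = schröderFrom false 0

delay : (ℕ → ℕ) → ℕ → ℕ
delay f zero    = 0
delay f (suc n) = f n

large-suc : ∀ w → large (suc w) ≡ schröderFrom true 1 w + delay large w
large-suc zero    = refl
large-suc (suc w) = refl

-- A path from height h + 1 splits at its first D-step down to height h into
-- a large Schröder path (shifted up to height h + 1) and a path from height h.
FirstDescent : ℕ → Set
FirstDescent w = ∀ l h → schröderFrom l (suc h) (suc w) ≡ conv large (schröderFrom l h) w

schröderFrom-firstDescent : ∀ w → FirstDescent w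
schröderFrom-firstDescent = <-rec FirstDescent λ w ih → step w (λ m → ih {m})
  where
  step : ∀ w → (∀ m → m < w → FirstDescent m) → FirstDescent w
  step zero    ih l h = sym (+-identityʳ (schröderFrom l h 0))
  step (suc w) ih l h = begin
    schröderFrom l (suc (suc h)) (suc w) + schröderFrom l h (suc w) + schröderFrom l (suc h) w
      ≡⟨ cong₂ (λ x y → x + schröderFrom l h (suc w) + y) (sym (afterUp w ih)) (sym (afterLevel w ih)) ⟩
    conv (schröderFrom true 1) g w + g (suc w) + conv (delay large) g w
      ≡⟨ regroup (conv (schröderFrom true 1) g w) (g (suc w)) (conv (delay large) g w) ⟩
    1 * g (suc w) + (conv (schröderFrom true 1) g w + conv (delay large) g w)
      ≡⟨ cong (1 * g (suc w) +_) (sym (conv-distribʳ-+ (schröderFrom true 1) (delay large) g w)) ⟩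
    1 * g (suc w) + conv (λ a → schröderFrom true 1 a + delay large a) g w
      ≡⟨ cong (1 * g (suc w) +_) (conv-cong w (λ a _ → sym (large-suc a)) (λ _ _ → refl)) ⟩
    1 * g (suc w) + conv (large ∘ suc) g w ∎
    where
    g = schröderFrom l h
    regroup : ∀ a b c → a + b + c ≡ 1 * b + (a + c)
    regroup = solve-∀
    afterLevel : ∀ w → (∀ m → m < suc w → FirstDescent m) →
                 conv (delay large) g w ≡ schröderFrom l (suc h) w
    afterLevel zero    ih = refl
    afterLevel (suc v) ih = sym (ih v (m≤n⇒m≤1+n (n<1+n v)) l h)
    afterUp : ∀ w → (∀ m → m < suc w → FirstDescent m) →
              conv (schröderFrom true 1) g w ≡ schröderFrom l (suc (suc h)) (suc w)
    afterUp zero    ih = refl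
    afterUp (suc v) ih = begin
      conv (schröderFrom true 1 ∘ suc) g v
        ≡⟨ conv-cong v (λ a a≤v → ih a (s≤s (m≤n⇒m≤1+n a≤v)) true 0) (λ _ _ → refl) ⟩
      conv (conv large large) g v
        ≡⟨ conv-assoc large large g v ⟩
      conv large (conv large g) v
        ≡⟨ conv-cong v (λ _ _ → refl) (λ b b≤v → sym (ih b (s≤s (m≤n⇒m≤1+n b≤v)) l h)) ⟩
      conv large (schröderFrom l (suc h) ∘ suc) v
        ≡⟨ sym (conv-sucʳ-zero large (schröderFrom l (suc h)) v refl) ⟩
      conv large (schröderFrom l (suc h)) (suc v)
        ≡⟨ sym (ih (suc v) ≤-refl l (suc h)) ⟩
      schröderFrom l (suc (suc h)) (suc (suc v)) ∎

little-suc-suc : ∀ w → little (suc (suc w)) ≡ conv large little w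
little-suc-suc w = trans (+-identityʳ _) (schröderFrom-firstDescent w false 0)

large-suc-suc : ∀ w → large (suc (suc w)) ≡ conv large large w + large w
large-suc-suc w = cong (_+ large w) (schröderFrom-firstDescent w true 0)

large+ε≡2*little : ∀ w → large w + ε w ≡ 2 * little w
large+ε≡2*little = <-rec _ λ w ih → step w (λ m → ih {m})
  where
  step : ∀ w → (∀ m → m < w → large m + ε m ≡ 2 * little m) → large w + ε w ≡ 2 * little w
  step zero          ih = refl
  step (suc zero)    ih = refl
  step (suc (suc w)) ih = begin
    large (suc (suc w)) + 0          ≡⟨ +-identityʳ _ ⟩
    large (suc (suc w))              ≡⟨ large-suc-suc w ⟩
    conv large large w + large w     ≡⟨ cong (conv large large w +_) (sym (conv-identityʳ large w)) ⟩
    conv large large w + conv large ε w ≡⟨ sym (conv-distribˡ-+ large large ε w) ⟩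
    conv large (λ i → large i + ε i) w ≡⟨ conv-cong w (λ _ _ → refl) (λ i i≤w → ih i (s≤s (m≤n⇒m≤1+n i≤w))) ⟩
    conv large (λ i → 2 * little i) w  ≡⟨ conv-scaleʳ 2 large little w ⟩
    2 * conv large little w            ≡⟨ cong (2 *_) (sym (little-suc-suc w)) ⟩
    2 * little (suc (suc w)) ∎

-- Decorated Dyck paths counted by width

upWeight : Bool → ℕ
upWeight false = 1
upWeight true  = 2

-- Dyck paths from height h of width w in which every U-step continuing an
-- ascent counts twice, so that an ascent of length k weighs 2 ^ (k ∸ 1) = |𝓕 k|;
-- the flag says whether the previous step was U.
weightedDyck : Bool → ℕ → ℕ → ℕ
weightedDyck u zero    zero    = 1
weightedDyck u (suc h) zero    = 0
weightedDyck u zero    (suc w) = upWeight u * weightedDyck true 1 w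
weightedDyck u (suc h) (suc w) = upWeight u * weightedDyck true (suc (suc h)) w + weightedDyck false h w

WeightedFirstDescent : ℕ → Set
WeightedFirstDescent w = ∀ u h → weightedDyck u (suc h) (suc w) ≡ conv (weightedDyck u 0) (weightedDyck false h) w

weightedDyck-firstDescent : ∀ w → WeightedFirstDescent w
weightedDyck-firstDescent = <-rec WeightedFirstDescent λ w ih → step w (λ m → ih {m})
  where
  step : ∀ w → (∀ m → m < w → WeightedFirstDescent m) → WeightedFirstDescent w
  step zero    ih u h = trans (cong (_+ weightedDyck false h 0) (*-zeroʳ (upWeight u))) (sym (+-identityʳ _))
  step (suc w) ih u h = begin
    upWeight u * weightedDyck true (suc (suc h)) (suc w) + g (suc w)
      ≡⟨ cong (λ x → upWeight u * x + g (suc w)) (sym (afterUp w ih)) ⟩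
    upWeight u * conv (weightedDyck true 1) g w + g (suc w)
      ≡⟨ +-comm _ (g (suc w)) ⟩
    g (suc w) + upWeight u * conv (weightedDyck true 1) g w
      ≡⟨ cong₂ _+_ (sym (*-identityˡ (g (suc w)))) (sym (conv-scaleˡ (upWeight u) (weightedDyck true 1) g w)) ⟩
    1 * g (suc w) + conv (λ a → upWeight u * weightedDyck true 1 a) g w ∎
    where
    g = weightedDyck false h
    afterUp : ∀ w → (∀ m → m < suc w → WeightedFirstDescent m) →
              conv (weightedDyck true 1) g w ≡ weightedDyck true (suc (suc h)) (suc w)
    afterUp zero    ih = sym (*-zeroʳ 2)
    afterUp (suc v) ih = begin
      conv (weightedDyck true 1 ∘ suc) g v
        ≡⟨ conv-cong v (λ a a≤v → ih a (s≤s (m≤n⇒m≤1+n a≤v)) true 0) (λ _ _ → refl) ⟩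
      conv (conv (weightedDyck true 0) (weightedDyck false 0)) g v
        ≡⟨ conv-assoc (weightedDyck true 0) (weightedDyck false 0) g v ⟩
      conv (weightedDyck true 0) (conv (weightedDyck false 0) g) v
        ≡⟨ conv-cong v (λ _ _ → refl) (λ c c≤v → sym (ih c (s≤s (m≤n⇒m≤1+n c≤v)) false h)) ⟩
      conv (weightedDyck true 0) (weightedDyck false (suc h) ∘ suc) v
        ≡⟨ sym (conv-sucʳ-zero (weightedDyck true 0) (weightedDyck false (suc h)) v refl) ⟩
      conv (weightedDyck true 0) (weightedDyck false (suc h)) (suc v)
        ≡⟨ sym (ih (suc v) ≤-refl true (suc h)) ⟩
      weightedDyck true (suc (suc h)) (suc (suc v)) ∎

weightedDyck≡schröder : ∀ w → weightedDyck false 0 w ≡ little w × weightedDyck true 0 w ≡ large w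
weightedDyck≡schröder = <-rec _ λ w ih → step w (λ m → ih {m})
  where
  step : ∀ w → (∀ m → m < w → weightedDyck false 0 m ≡ little m × weightedDyck true 0 m ≡ large m) →
         weightedDyck false 0 w ≡ little w × weightedDyck true 0 w ≡ large w
  step zero          ih = refl , refl
  step (suc zero)    ih = refl , refl
  step (suc (suc w)) ih = falseCase , trueCase
    where
    X Y : ℕ → ℕ
    X = weightedDyck false 0
    Y = weightedDyck true 0
    X-suc-suc : X (suc (suc w)) ≡ conv Y X w
    X-suc-suc = trans (+-identityʳ _) (weightedDyck-firstDescent w true 0)
    Y-suc-suc : Y (suc (suc w)) ≡ 2 * conv Y X w
    Y-suc-suc = cong (2 *_) (weightedDyck-firstDescent w true 0)
    conv≡ : conv Y X w ≡ conv large little w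
    conv≡ = conv-cong w (λ i i≤w → proj₂ (ih i (s≤s (m≤n⇒m≤1+n i≤w))))
                        (λ i i≤w → proj₁ (ih i (s≤s (m≤n⇒m≤1+n i≤w))))
    falseCase : X (suc (suc w)) ≡ little (suc (suc w))
    falseCase = trans X-suc-suc (trans conv≡ (sym (little-suc-suc w)))
    trueCase : Y (suc (suc w)) ≡ large (suc (suc w))
    trueCase = begin
      Y (suc (suc w))                      ≡⟨ Y-suc-suc ⟩
      2 * conv Y X w                       ≡⟨ cong (2 *_) conv≡ ⟩
      2 * conv large little w              ≡⟨ sym (conv-scaleʳ 2 large little w) ⟩
      conv large (λ i → 2 * little i) w    ≡⟨ sym (conv-cong w (λ _ _ → refl) (λ i _ → large+ε≡2*little i)) ⟩
      conv large (λ i → large i + ε i) w   ≡⟨ conv-distribˡ-+ large large ε w ⟩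
      conv large large w + conv large ε w  ≡⟨ cong (conv large large w +_) (conv-identityʳ large w) ⟩
      conv large large w + large w         ≡⟨ sym (large-suc-suc w) ⟩
      large (suc (suc w)) ∎

-- Dyck paths from height h of width w with an open ascent of length c, each
-- completed ascent of length k + 1 weighted by |𝓕 (k + 1)| = 2 ^ k.
decoratedDyck : ℕ → ℕ → ℕ → ℕ
decoratedDyck zero    zero    zero    = 1
decoratedDyck zero    (suc k) zero    = 2 ^ k
decoratedDyck (suc h) c       zero    = 0
decoratedDyck zero    c       (suc w) = decoratedDyck 1 (suc c) w
decoratedDyck (suc h) zero    (suc w) = decoratedDyck (suc (suc h)) 1 w + decoratedDyck h 0 w
decoratedDyck (suc h) (suc k) (suc w) = decoratedDyck (suc (suc h)) (suc (suc k)) w + 2 ^ k * decoratedDyck h 0 w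

decoratedDyck≡weightedDyck : ∀ w h → decoratedDyck h 0 w ≡ weightedDyck false h w ×
                                      (∀ k → decoratedDyck h (suc k) w ≡ 2 ^ k * weightedDyck true h w)
decoratedDyck≡weightedDyck zero    zero    = refl , λ k → sym (*-identityʳ _)
decoratedDyck≡weightedDyck zero    (suc h) = refl , λ k → sym (*-zeroʳ (2 ^ k))
decoratedDyck≡weightedDyck (suc w) zero    =
  proj₂ (decoratedDyck≡weightedDyck w 1) 0 ,
  λ k → trans (proj₂ (decoratedDyck≡weightedDyck w 1) (suc k)) (regroup (2 ^ k) (weightedDyck true 1 w))
  where
  regroup : ∀ a d → 2 * a * d ≡ a * (2 * d)
  regroup = solve-∀
decoratedDyck≡weightedDyck (suc w) (suc h) =
  cong₂ _+_ (proj₂ up 0) (proj₁ down) ,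
  λ k → trans (cong₂ _+_ (proj₂ up (suc k)) (cong (2 ^ k *_) (proj₁ down)))
              (regroup (2 ^ k) (weightedDyck true (suc (suc h)) w) (weightedDyck false h w))
  where
  up   = decoratedDyck≡weightedDyck w (suc (suc h))
  down = decoratedDyck≡weightedDyck w h
  regroup : ∀ a d g → 2 * a * d + a * g ≡ a * (2 * d + g)
  regroup = solve-∀

odd : ℕ → Bool
odd zero    = false
odd (suc n) = not (odd n)

odd-suc-suc : ∀ n → odd (suc (suc n)) ≡ odd n
odd-suc-suc n = not-involutive (odd n)

schröderFrom-odd : ∀ w h l → odd (h + w) ≡ true → schröderFrom l h w ≡ 0
schröderFrom-odd zero          zero          l ()
schröderFrom-odd zero          (suc h)       l _ = refl
schröderFrom-odd (suc zero)    zero          l _ = refl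
schröderFrom-odd (suc (suc w)) zero          l o =
  cong₂ _+_ (schröderFrom-odd (suc w) 1 l o) (onAxis l)
  where
  onAxis : ∀ l → (if l then schröderFrom l 0 w else 0) ≡ 0
  onAxis false = refl
  onAxis true  = schröderFrom-odd w 0 true (trans (sym (odd-suc-suc w)) o)
schröderFrom-odd (suc zero)    (suc zero)    l ()
schröderFrom-odd (suc zero)    (suc (suc h)) l _ = refl
schröderFrom-odd (suc (suc w)) (suc h)       l o =
  cong₂ _+_ (cong₂ _+_ (schröderFrom-odd (suc w) (suc (suc h)) l (trans (cong odd up) o))
                       (schröderFrom-odd (suc w) h l (trans (sym (odd-suc-suc (h + suc w))) (trans (cong odd down) o))))
            (schröderFrom-odd w (suc h) l (trans (sym (odd-suc-suc (suc h + w))) (trans (cong odd level) o)))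
  where
  up : suc (suc h) + suc w ≡ suc h + suc (suc w)
  up = cong suc (sym (+-suc h (suc w)))
  down : suc (suc (h + suc w)) ≡ suc h + suc (suc w)
  down = cong suc (sym (+-suc h (suc w)))
  level : suc (suc (suc h + w)) ≡ suc h + suc (suc w)
  level = cong suc (trans (cong suc (sym (+-suc h w))) (sym (+-suc h (suc w))))

double : ℕ → ℕ
double zero    = zero
double (suc n) = suc (suc (double n))

odd-double : ∀ n → odd (double n) ≡ false
odd-double zero    = refl
odd-double (suc n) = trans (odd-suc-suc (double n)) (odd-double n)

large-odd : ∀ i → large (suc (double i)) ≡ 0
large-odd i = schröderFrom-odd (suc (double i)) 0 true (cong not (odd-double i))

conv-double : ∀ n f g → (∀ i → f (suc (double i)) ≡ 0) → conv f g (double n) ≡ conv (f ∘ double) (g ∘ double) n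
conv-double zero    f g f-odd = refl
conv-double (suc n) f g f-odd =
  cong (f 0 * g (suc (suc (double n))) +_)
    (trans (cong (λ x → x * g (suc (double n)) + conv (f ∘ suc ∘ suc) g (double n)) (f-odd 0))
           (conv-double n (f ∘ suc ∘ suc) g (f-odd ∘ suc)))

2*≡double : ∀ n → 2 * n ≡ double n
2*≡double zero    = refl
2*≡double (suc n) = trans (cong suc (+-suc n (n + 0))) (cong (suc ∘ suc) (2*≡double n))

ε-double : ∀ n → ε (double n) ≡ ε n
ε-double zero    = refl
ε-double (suc n) = refl

Fin-cong : ∀ {m n} → m ≡ n → Fin m ↔ Fin n
Fin-cong refl = ↔-refl

_⊎↔+_ : ∀ {A B : Set} {m n} → A ↔ Fin m → B ↔ Fin n → (A ⊎ B) ↔ Fin (m + n)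
A↔m ⊎↔+ B↔n = ↔-trans (A↔m ⊎-↔ B↔n) (↔-sym +↔⊎)

_×↔*_ : ∀ {A B : Set} {m n} → A ↔ Fin m → B ↔ Fin n → (A × B) ↔ Fin (m * n)
A↔m ×↔* B↔n = ↔-trans (A↔m ×-↔ B↔n) (↔-sym *↔×)

infixr 4 _⊎↔+_
infixr 5 _×↔*_

T-∧⁻ : ∀ {a b} → T (a ∧ b) → T a × T b
T-∧⁻ = Equivalence.to T-∧

T-∧⁺ : ∀ {a b} → T a × T b → T (a ∧ b)
T-∧⁺ = Equivalence.from T-∧

T-∧-false : ∀ {b} → T (b ∧ false) → ⊥
T-∧-false {true}  ()
T-∧-false {false} ()

Σ-T-≡ : ∀ {A : Set} {P : A → Bool} {x y : Σ A (T ∘ P)} → proj₁ x ≡ proj₁ y → x ≡ y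
Σ-T-≡ {P = P} {a , p} {.a , q} refl = cong (a ,_) (T-irrelevant p q)


SchröderPath : ℕ → ℕ → Set
SchröderPath h w = Σ (List UDL) λ p → T ((width p ≡ᵇ w) ∧ schFrom h p)

SchröderPath-empty : SchröderPath 0 0 ↔ ⊤
SchröderPath-empty = mk↔ₛ′ (λ _ → tt) (λ _ → [] , tt) (λ _ → refl) from∘to
  where
  from∘to : ∀ p → ([] , tt) ≡ p
  from∘to ([] , tt) = refl
  from∘to (sU ∷ _ , ())
  from∘to (sD ∷ _ , ())
  from∘to (sL ∷ _ , ())

SchröderPath-unfinished : ∀ h → SchröderPath (suc h) 0 ↔ ⊥
SchröderPath-unfinished h = mk↔ₛ′ to (λ ()) (λ ()) (λ p → ⊥-elim (to p))
  where
  to : SchröderPath (suc h) 0 → ⊥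
  to ([] , ())
  to (sU ∷ _ , ())
  to (sD ∷ _ , ())
  to (sL ∷ _ , ())

SchröderPath-axis : ∀ w → SchröderPath 0 (suc w) ↔ SchröderPath 1 w
SchröderPath-axis w = mk↔ₛ′ to (λ (p , q) → sU ∷ p , q) (λ _ → refl) from∘to
  where
  to : SchröderPath 0 (suc w) → SchröderPath 1 w
  to (sU ∷ p , q) = p , q
  to (sD ∷ _ , q) = ⊥-elim (T-∧-false q)
  to (sL ∷ _ , q) = ⊥-elim (T-∧-false q)
  from∘to : ∀ p → (sU ∷ proj₁ (to p) , proj₂ (to p)) ≡ p
  from∘to (sU ∷ p , q) = refl
  from∘to (sD ∷ _ , q) = ⊥-elim (T-∧-false q)
  from∘to (sL ∷ _ , q) = ⊥-elim (T-∧-false q)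

SchröderPath-width1 : ∀ h → SchröderPath (suc h) 1 ↔ (SchröderPath (suc (suc h)) 0 ⊎ SchröderPath h 0)
SchröderPath-width1 h = mk↔ₛ′ to from (λ { (inj₁ _) → refl ; (inj₂ _) → refl }) from∘to
  where
  to : SchröderPath (suc h) 1 → SchröderPath (suc (suc h)) 0 ⊎ SchröderPath h 0
  to (sU ∷ p , q) = inj₁ (p , q)
  to (sD ∷ p , q) = inj₂ (p , q)
  to (sL ∷ p , ())
  from : SchröderPath (suc (suc h)) 0 ⊎ SchröderPath h 0 → SchröderPath (suc h) 1
  from (inj₁ (p , q)) = sU ∷ p , q
  from (inj₂ (p , q)) = sD ∷ p , q
  from∘to : ∀ p → from (to p) ≡ p
  from∘to (sU ∷ p , q) = refl
  from∘to (sD ∷ p , q) = refl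
  from∘to (sL ∷ p , ())

SchröderPath-step : ∀ h w → SchröderPath (suc h) (suc (suc w)) ↔
  ((SchröderPath (suc (suc h)) (suc w) ⊎ SchröderPath h (suc w)) ⊎ SchröderPath (suc h) w)
SchröderPath-step h w =
  mk↔ₛ′ to from (λ { (inj₁ (inj₁ _)) → refl ; (inj₁ (inj₂ _)) → refl ; (inj₂ _) → refl }) from∘to
  where
  to : SchröderPath (suc h) (suc (suc w)) →
       (SchröderPath (suc (suc h)) (suc w) ⊎ SchröderPath h (suc w)) ⊎ SchröderPath (suc h) w
  to (sU ∷ p , q) = inj₁ (inj₁ (p , q))
  to (sD ∷ p , q) = inj₁ (inj₂ (p , q))
  to (sL ∷ p , q) = inj₂ (p , q)
  from : (SchröderPath (suc (suc h)) (suc w) ⊎ SchröderPath h (suc w)) ⊎ SchröderPath (suc h) w →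
         SchröderPath (suc h) (suc (suc w))
  from (inj₁ (inj₁ (p , q))) = sU ∷ p , q
  from (inj₁ (inj₂ (p , q))) = sD ∷ p , q
  from (inj₂ (p , q))        = sL ∷ p , q
  from∘to : ∀ p → from (to p) ≡ p
  from∘to (sU ∷ p , q) = refl
  from∘to (sD ∷ p , q) = refl
  from∘to (sL ∷ p , q) = refl

SchröderPath↔Fin : ∀ w h → SchröderPath h w ↔ Fin (schröderFrom false h w)
SchröderPath↔Fin zero          zero    = ↔-trans SchröderPath-empty (↔-sym 1↔⊤)
SchröderPath↔Fin zero          (suc h) = ↔-trans (SchröderPath-unfinished h) (↔-sym 0↔⊥)
SchröderPath↔Fin (suc zero)    zero    = ↔-trans (SchröderPath-axis 0) (SchröderPath↔Fin 0 1)
SchröderPath↔Fin (suc (suc w)) zero    =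
  ↔-trans (SchröderPath-axis (suc w)) (↔-trans (SchröderPath↔Fin (suc w) 1) (Fin-cong (sym (+-identityʳ _))))
SchröderPath↔Fin (suc zero)    (suc h) =
  ↔-trans (SchröderPath-width1 h) (SchröderPath↔Fin 0 (suc (suc h)) ⊎↔+ SchröderPath↔Fin 0 h)
SchröderPath↔Fin (suc (suc w)) (suc h) =
  ↔-trans (SchröderPath-step h w)
          ((SchröderPath↔Fin (suc w) (suc (suc h)) ⊎↔+ SchröderPath↔Fin (suc w) h) ⊎↔+ SchröderPath↔Fin w (suc h))

LS↔Fin : ∀ n → LS n ↔ Fin (little (2 * n))
LS↔Fin n = SchröderPath↔Fin (2 * n) 0

-- Pyramid sequences are compositions

ups downs : ℕ → List UD → List UD
ups   zero    r = r
ups   (suc n) r = U ∷ ups n r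
downs zero    r = r
downs (suc n) r = D ∷ downs n r

-- An entry j stands for the pyramid U^(j+1) D^(j+1).
pyramids : List ℕ → List UD
pyramids []       = []
pyramids (j ∷ js) = U ∷ ups j (D ∷ downs j (pyramids js))

size : List ℕ → ℕ
size []       = 0
size (j ∷ js) = suc j + size js

Composition : ℕ → Set
Composition k = Σ (List ℕ) λ js → T (size js ≡ᵇ k)

parsePyramids : ℕ → List UD → List ℕ
parsePyramids _       []          = []
parsePyramids zero    (_ ∷ _)     = []
parsePyramids (suc f) w@(_ ∷ _) with leadingU w
... | (zero , _) = []
... | (suc j , r) with dropDs (suc j) r
...   | nothing = []
...   | just r′ = j ∷ parsePyramids f r′

leadingU-ups : ∀ w {j r} → leadingU w ≡ (j , r) → ups j r ≡ w
leadingU-ups []      refl = refl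
leadingU-ups (D ∷ w) refl = refl
leadingU-ups (U ∷ w) eq with leadingU w in eq′
leadingU-ups (U ∷ w) refl | (j , r) = cong (U ∷_) (leadingU-ups w eq′)

dropDs-downs : ∀ j r {r′} → dropDs j r ≡ just r′ → downs j r′ ≡ r
dropDs-downs zero    r       refl = refl
dropDs-downs (suc j) (D ∷ r) eq   = cong (D ∷_) (dropDs-downs j r eq)
dropDs-downs (suc j) (U ∷ r) ()
dropDs-downs (suc j) []      ()

pyramids-parsePyramids : ∀ f w → T (pyramidsFuel f w) → pyramids (parsePyramids f w) ≡ w
pyramids-parsePyramids _       []      _ = refl
pyramids-parsePyramids zero    (x ∷ w) ()
pyramids-parsePyramids (suc f) (x ∷ w) p with leadingU (x ∷ w) in eqU
... | (zero , _) = ⊥-elim p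
... | (suc j , r) with dropDs (suc j) r in eqD
...   | nothing = ⊥-elim p
...   | just r′ = begin
  ups (suc j) (downs (suc j) (pyramids (parsePyramids f r′)))
    ≡⟨ cong (ups (suc j) ∘ downs (suc j)) (pyramids-parsePyramids f r′ p) ⟩
  ups (suc j) (downs (suc j) r′)
    ≡⟨ cong (ups (suc j)) (dropDs-downs (suc j) r eqD) ⟩
  ups (suc j) r
    ≡⟨ leadingU-ups (x ∷ w) eqU ⟩
  x ∷ w ∎

leadingU-pyramid : ∀ j r → leadingU (ups j (D ∷ r)) ≡ (j , D ∷ r)
leadingU-pyramid zero    r = refl
leadingU-pyramid (suc j) r rewrite leadingU-pyramid j r = refl

dropDs-downs⁻ : ∀ j r → dropDs j (downs j r) ≡ just r
dropDs-downs⁻ zero    r = refl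
dropDs-downs⁻ (suc j) r = dropDs-downs⁻ j r

parsePyramids-pyramids : ∀ js f → length js ≤ f →
  T (pyramidsFuel f (pyramids js)) × parsePyramids f (pyramids js) ≡ js
parsePyramids-pyramids []       f       _          = tt , refl
parsePyramids-pyramids (j ∷ js) (suc f) (s≤s js≤f)
  rewrite leadingU-pyramid j (downs j (pyramids js)) | dropDs-downs⁻ j (pyramids js) =
  proj₁ (parsePyramids-pyramids js f js≤f) , cong (j ∷_) (proj₂ (parsePyramids-pyramids js f js≤f))

length-ups : ∀ n r → length (ups n r) ≡ n + length r
length-ups zero    r = refl
length-ups (suc n) r = cong suc (length-ups n r)

length-downs : ∀ n r → length (downs n r) ≡ n + length r
length-downs zero    r = refl
length-downs (suc n) r = cong suc (length-downs n r)

length-pyramids : ∀ js → length (pyramids js) ≡ 2 * size js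
length-pyramids []       = refl
length-pyramids (j ∷ js) = begin
  suc (length (ups j (D ∷ downs j (pyramids js)))) ≡⟨ cong suc (length-ups j _) ⟩
  suc (j + suc (length (downs j (pyramids js))))   ≡⟨ cong (λ n → suc (j + suc n)) (length-downs j _) ⟩
  suc (j + suc (j + length (pyramids js)))         ≡⟨ cong (λ n → suc (j + suc (j + n))) (length-pyramids js) ⟩
  suc (j + suc (j + 2 * size js))                  ≡⟨ regroup j (size js) ⟩
  2 * (suc j + size js) ∎
  where
  regroup : ∀ a b → suc (a + suc (a + 2 * b)) ≡ 2 * (suc a + b)
  regroup = solve-∀

length≤size : ∀ js → length js ≤ size js
length≤size []       = z≤n
length≤size (j ∷ js) = s≤s (≤-trans (length≤size js) (m≤n+m (size js) j))

length≤length-pyramids : ∀ js → length js ≤ length (pyramids js)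
length≤length-pyramids js =
  subst (length js ≤_) (sym (length-pyramids js)) (≤-trans (length≤size js) (m≤m+n (size js) (size js + 0)))

dyckFrom-ups : ∀ n h r → dyckFrom h (ups n r) ≡ dyckFrom (n + h) r
dyckFrom-ups zero    h       r = refl
dyckFrom-ups (suc n) zero    r = trans (dyckFrom-ups n 1 r) (cong (λ z → dyckFrom z r) (+-suc n 0))
dyckFrom-ups (suc n) (suc h) r = trans (dyckFrom-ups n (suc (suc h)) r) (cong (λ z → dyckFrom z r) (+-suc n (suc h)))

dyckFrom-downs : ∀ n h r → dyckFrom (n + h) (downs n r) ≡ dyckFrom h r
dyckFrom-downs zero    h r = refl
dyckFrom-downs (suc n) h r = dyckFrom-downs n h r

dyckFrom-pyramids : ∀ h js → dyckFrom h (pyramids js) ≡ dyckFrom h []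
dyckFrom-pyramids h []       = refl
dyckFrom-pyramids h (j ∷ js) = begin
  dyckFrom h (ups (suc j) (downs (suc j) (pyramids js))) ≡⟨ dyckFrom-ups (suc j) h _ ⟩
  dyckFrom (suc j + h) (downs (suc j) (pyramids js))    ≡⟨ dyckFrom-downs (suc j) h _ ⟩
  dyckFrom h (pyramids js)                              ≡⟨ dyckFrom-pyramids h js ⟩
  dyckFrom h [] ∎

𝓕↔Composition : ∀ k → 𝓕 k ↔ Composition k
𝓕↔Composition k = mk↔ₛ′ to from to∘from from∘to
  where
  parsed : ∀ w → T (isPyramids w) → pyramids (parsePyramids (length w) w) ≡ w
  parsed w = pyramids-parsePyramids (length w) w
  reparsed : ∀ js → T (isPyramids (pyramids js)) × parsePyramids (length (pyramids js)) (pyramids js) ≡ js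
  reparsed js = parsePyramids-pyramids js (length (pyramids js)) (length≤length-pyramids js)
  to : 𝓕 k → Composition k
  to (w , p) = js , ≡⇒≡ᵇ (size js) k (*-cancelˡ-≡ (size js) k 2 2*size≡2*k)
    where
    dyck = proj₁ (T-∧⁻ p)
    js = parsePyramids (length w) w
    2*size≡2*k : 2 * size js ≡ 2 * k
    2*size≡2*k = begin
      2 * size js          ≡⟨ sym (length-pyramids js) ⟩
      length (pyramids js) ≡⟨ cong length (parsed w (proj₂ (T-∧⁻ p))) ⟩
      length w             ≡⟨ ≡ᵇ⇒≡ (length w) (2 * k) (proj₁ (T-∧⁻ dyck)) ⟩
      2 * k ∎
  from : Composition k → 𝓕 k
  from (js , q) = pyramids js , T-∧⁺ (T-∧⁺ (lengthOk , dyck) , proj₁ (reparsed js))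
    where
    lengthOk : T (length (pyramids js) ≡ᵇ 2 * k)
    lengthOk = ≡⇒≡ᵇ _ _ (trans (length-pyramids js) (cong (2 *_) (≡ᵇ⇒≡ (size js) k q)))
    dyck : T (dyckFrom 0 (pyramids js))
    dyck = Equivalence.from T-≡ (dyckFrom-pyramids 0 js)
  to∘from : ∀ c → to (from c) ≡ c
  to∘from (js , _) = Σ-T-≡ (proj₂ (reparsed js))
  from∘to : ∀ f → from (to f) ≡ f
  from∘to (w , p) = Σ-T-≡ (parsed w (proj₂ (T-∧⁻ p)))

Composition-one : Composition 1 ↔ ⊤
Composition-one = mk↔ₛ′ (λ _ → tt) (λ _ → (0 ∷ []) , tt) (λ _ → refl) from∘to
  where
  from∘to : ∀ c → ((0 ∷ []) , tt) ≡ c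
  from∘to ([] , ())
  from∘to ((zero ∷ []) , tt) = refl
  from∘to ((zero ∷ _ ∷ _) , ())
  from∘to ((suc _ ∷ _) , ())

-- Either the first part is 1 and is dropped, or it is decreased by 1.
Composition-suc : ∀ k → Composition (suc (suc k)) ↔ (Composition (suc k) ⊎ Composition (suc k))
Composition-suc k = mk↔ₛ′ to from to∘from from∘to
  where
  to : Composition (suc (suc k)) → Composition (suc k) ⊎ Composition (suc k)
  to ([] , ())
  to ((zero ∷ js) , q)  = inj₁ (js , q)
  to ((suc j ∷ js) , q) = inj₂ ((j ∷ js) , q)
  from : Composition (suc k) ⊎ Composition (suc k) → Composition (suc (suc k))
  from (inj₁ (js , q))       = (zero ∷ js) , q
  from (inj₂ ([] , ()))
  from (inj₂ ((j ∷ js) , q)) = (suc j ∷ js) , q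
  to∘from : ∀ c → to (from c) ≡ c
  to∘from (inj₁ _) = refl
  to∘from (inj₂ ([] , ()))
  to∘from (inj₂ ((_ ∷ _) , _)) = refl
  from∘to : ∀ c → from (to c) ≡ c
  from∘to ([] , ())
  from∘to ((zero ∷ _) , _)  = refl
  from∘to ((suc _ ∷ _) , _) = refl

Composition↔Fin : ∀ k → Composition (suc k) ↔ Fin (2 ^ k)
Composition↔Fin zero    = ↔-trans Composition-one (↔-sym 1↔⊤)
Composition↔Fin (suc k) =
  ↔-trans (Composition-suc k)
          (↔-trans (Composition↔Fin k ⊎↔+ Composition↔Fin k) (Fin-cong (cong (2 ^ k +_) (sym (+-identityʳ (2 ^ k))))))

𝓕↔Fin : ∀ k → 𝓕 (suc k) ↔ Fin (2 ^ k)
𝓕↔Fin k = ↔-trans (𝓕↔Composition (suc k)) (Composition↔Fin k)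


DecoratedDyck : ℕ → ℕ → ℕ → Set
DecoratedDyck h c w = Σ (List UD) λ p → T ((length p ≡ᵇ w) ∧ dyckFrom h p) × All 𝓕 (ascentsGo c p)

DecoratedDyck-empty : DecoratedDyck 0 0 0 ↔ ⊤
DecoratedDyck-empty = mk↔ₛ′ (λ _ → tt) (λ _ → [] , tt , []) (λ _ → refl) from∘to
  where
  from∘to : ∀ p → ([] , tt , []) ≡ p
  from∘to ([] , tt , []) = refl
  from∘to (U ∷ _ , () , _)
  from∘to (D ∷ _ , () , _)

DecoratedDyck-end : ∀ k → DecoratedDyck 0 (suc k) 0 ↔ 𝓕 (suc k)
DecoratedDyck-end k = mk↔ₛ′ to (λ f → [] , tt , f ∷ []) (λ _ → refl) from∘to
  where
  to : DecoratedDyck 0 (suc k) 0 → 𝓕 (suc k)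
  to ([] , _ , f ∷ []) = f
  to (U ∷ _ , () , _)
  to (D ∷ _ , () , _)
  from∘to : ∀ p → ([] , tt , to p ∷ []) ≡ p
  from∘to ([] , tt , f ∷ []) = refl
  from∘to (U ∷ _ , () , _)
  from∘to (D ∷ _ , () , _)

DecoratedDyck-unfinished : ∀ h c → DecoratedDyck (suc h) c 0 ↔ ⊥
DecoratedDyck-unfinished h c = mk↔ₛ′ to (λ ()) (λ ()) (λ p → ⊥-elim (to p))
  where
  to : DecoratedDyck (suc h) c 0 → ⊥
  to ([] , () , _)
  to (U ∷ _ , () , _)
  to (D ∷ _ , () , _)

-- ascentsGo c (U ∷ p) only reduces once c is a constructor, hence the splits on c.
DecoratedDyck-axis : ∀ c w → DecoratedDyck 0 c (suc w) ↔ DecoratedDyck 1 (suc c) w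
DecoratedDyck-axis c w = mk↔ₛ′ (to c) (from c) (to∘from c) (from∘to c)
  where
  to : ∀ c → DecoratedDyck 0 c (suc w) → DecoratedDyck 1 (suc c) w
  to zero    (U ∷ p , q , a) = p , q , a
  to (suc _) (U ∷ p , q , a) = p , q , a
  to _       (D ∷ _ , q , _) = ⊥-elim (T-∧-false q)
  from : ∀ c → DecoratedDyck 1 (suc c) w → DecoratedDyck 0 c (suc w)
  from zero    (p , q , a) = U ∷ p , q , a
  from (suc _) (p , q , a) = U ∷ p , q , a
  to∘from : ∀ c p → to c (from c p) ≡ p
  to∘from zero    _ = refl
  to∘from (suc _) _ = refl
  from∘to : ∀ c p → from c (to c p) ≡ p
  from∘to zero    (U ∷ _ , _ , _) = refl
  from∘to (suc _) (U ∷ _ , _ , _) = refl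
  from∘to _       (D ∷ _ , q , _) = ⊥-elim (T-∧-false q)

DecoratedDyck-step : ∀ h w → DecoratedDyck (suc h) 0 (suc w) ↔ (DecoratedDyck (suc (suc h)) 1 w ⊎ DecoratedDyck h 0 w)
DecoratedDyck-step h w = mk↔ₛ′ to from (λ { (inj₁ _) → refl ; (inj₂ _) → refl }) from∘to
  where
  to : DecoratedDyck (suc h) 0 (suc w) → DecoratedDyck (suc (suc h)) 1 w ⊎ DecoratedDyck h 0 w
  to (U ∷ p , q , a) = inj₁ (p , q , a)
  to (D ∷ p , q , a) = inj₂ (p , q , a)
  from : DecoratedDyck (suc (suc h)) 1 w ⊎ DecoratedDyck h 0 w → DecoratedDyck (suc h) 0 (suc w)
  from (inj₁ (p , q , a)) = U ∷ p , q , a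
  from (inj₂ (p , q , a)) = D ∷ p , q , a
  from∘to : ∀ p → from (to p) ≡ p
  from∘to (U ∷ p , q , a) = refl
  from∘to (D ∷ p , q , a) = refl

-- A D-step closes the open ascent, which takes its decoration along.
DecoratedDyck-ascentStep : ∀ h k w → DecoratedDyck (suc h) (suc k) (suc w) ↔
  (DecoratedDyck (suc (suc h)) (suc (suc k)) w ⊎ (𝓕 (suc k) × DecoratedDyck h 0 w))
DecoratedDyck-ascentStep h k w = mk↔ₛ′ to from (λ { (inj₁ _) → refl ; (inj₂ _) → refl }) from∘to
  where
  to : DecoratedDyck (suc h) (suc k) (suc w) → DecoratedDyck (suc (suc h)) (suc (suc k)) w ⊎ (𝓕 (suc k) × DecoratedDyck h 0 w)
  to (U ∷ p , q , a)     = inj₁ (p , q , a)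
  to (D ∷ p , q , f ∷ a) = inj₂ (f , p , q , a)
  from : DecoratedDyck (suc (suc h)) (suc (suc k)) w ⊎ (𝓕 (suc k) × DecoratedDyck h 0 w) → DecoratedDyck (suc h) (suc k) (suc w)
  from (inj₁ (p , q , a))     = U ∷ p , q , a
  from (inj₂ (f , p , q , a)) = D ∷ p , q , f ∷ a
  from∘to : ∀ p → from (to p) ≡ p
  from∘to (U ∷ p , q , a)     = refl
  from∘to (D ∷ p , q , f ∷ a) = refl

DecoratedDyck↔Fin : ∀ w h c → DecoratedDyck h c w ↔ Fin (decoratedDyck h c w)
DecoratedDyck↔Fin zero    zero    zero    = ↔-trans DecoratedDyck-empty (↔-sym 1↔⊤)
DecoratedDyck↔Fin zero    zero    (suc k) = ↔-trans (DecoratedDyck-end k) (𝓕↔Fin k)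
DecoratedDyck↔Fin zero    (suc h) c       = ↔-trans (DecoratedDyck-unfinished h c) (↔-sym 0↔⊥)
DecoratedDyck↔Fin (suc w) zero    zero    = ↔-trans (DecoratedDyck-axis 0 w) (DecoratedDyck↔Fin w 1 1)
DecoratedDyck↔Fin (suc w) zero    (suc k) = ↔-trans (DecoratedDyck-axis (suc k) w) (DecoratedDyck↔Fin w 1 (suc (suc k)))
DecoratedDyck↔Fin (suc w) (suc h) zero    =
  ↔-trans (DecoratedDyck-step h w) (DecoratedDyck↔Fin w (suc (suc h)) 1 ⊎↔+ DecoratedDyck↔Fin w h 0)
DecoratedDyck↔Fin (suc w) (suc h) (suc k) =
  ↔-trans (DecoratedDyck-ascentStep h k w)
          (DecoratedDyck↔Fin w (suc (suc h)) (suc (suc k)) ⊎↔+ 𝓕↔Fin k ×↔* DecoratedDyck↔Fin w h 0)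

DF↔Fin : ∀ n → DF n ↔ Fin (decoratedDyck 0 0 (2 * n))
DF↔Fin n = ↔-trans reassociate (DecoratedDyck↔Fin (2 * n) 0 0)
  where
  reassociate : DF n ↔ DecoratedDyck 0 0 (2 * n)
  reassociate = mk↔ₛ′ (λ ((p , q) , a) → p , q , a) (λ (p , q , a) → (p , q) , a) (λ _ → refl) (λ _ → refl)

-- Counting non-crossing sets of chords

Chord : Set
Chord = ℕ × ℕ

count : {A : Set} → (A → Bool) → List A → ℕ
count p []       = 0
count p (x ∷ xs) = if p x then suc (count p xs) else count p xs

length-filter≡count : {A : Set} (p : A → Bool) (xs : List A) → length (filter (T? ∘ p) xs) ≡ count p xs
length-filter≡count p []       = refl
length-filter≡count p (x ∷ xs) with p x
... | true  = cong suc (length-filter≡count p xs)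
... | false = length-filter≡count p xs

count-++ : {A : Set} (p : A → Bool) (xs ys : List A) → count p (xs ++ ys) ≡ count p xs + count p ys
count-++ p []       ys = refl
count-++ p (x ∷ xs) ys with p x
... | true  = cong suc (count-++ p xs ys)
... | false = count-++ p xs ys

count-map : {A B : Set} (p : B → Bool) (f : A → B) (xs : List A) → count p (map f xs) ≡ count (p ∘ f) xs
count-map p f []       = refl
count-map p f (x ∷ xs) with p (f x)
... | true  = cong suc (count-map p f xs)
... | false = count-map p f xs

count-cong : {A : Set} {p q : A → Bool} (xs : List A) → (∀ {x} → x ∈ xs → p x ≡ q x) → count p xs ≡ count q xs
count-cong             []       p≗q = refl
count-cong {p = p} {q} (x ∷ xs) p≗q rewrite p≗q (here refl) with q x
... | true  = cong suc (count-cong xs (p≗q ∘ there))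
... | false = count-cong xs (p≗q ∘ there)

count-false : {A : Set} (xs : List A) → count (λ _ → false) xs ≡ 0
count-false []       = refl
count-false (_ ∷ xs) = count-false xs

count-∧ : {A : Set} (b : Bool) (p : A → Bool) (xs : List A) → count (λ x → b ∧ p x) xs ≡ (if b then 1 else 0) * count p xs
count-∧ true  p xs = sym (+-identityʳ _)
count-∧ false p xs = count-false xs

Compatible : List Chord → List Chord → Set
Compatible xs ys = ∀ {x y} → x ∈ xs → y ∈ ys → crosses x y ≡ false

NonCrossing : List Chord → Set
NonCrossing xs = Compatible xs xs

allB-elim : {A : Set} (p : A → Bool) (xs : List A) → allB p xs ≡ true → ∀ {x} → x ∈ xs → p x ≡ true
allB-elim p (y ∷ xs) e (here refl) with p y
... | true = refl
allB-elim p (y ∷ xs) e (there x∈xs) with p y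
... | true = allB-elim p xs e x∈xs

allB-intro : {A : Set} (p : A → Bool) (xs : List A) → (∀ {x} → x ∈ xs → p x ≡ true) → allB p xs ≡ true
allB-intro p []       h = refl
allB-intro p (y ∷ xs) h rewrite h (here refl) = allB-intro p xs (h ∘ there)

nonCrossing-sound : ∀ xs → nonCrossing xs ≡ true → NonCrossing xs
nonCrossing-sound xs e x∈ y∈ = not-true (allB-elim _ xs (allB-elim _ xs e x∈) y∈)
  where
  not-true : ∀ {b} → not b ≡ true → b ≡ false
  not-true {false} _ = refl

nonCrossing-complete : ∀ xs → NonCrossing xs → nonCrossing xs ≡ true
nonCrossing-complete xs nc = allB-intro _ xs λ x∈ → allB-intro _ xs λ y∈ → cong not (nc x∈ y∈)

nonCrossing-⊆ : ∀ {xs ys} → xs ⊆ ys → nonCrossing ys ≡ true → nonCrossing xs ≡ true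
nonCrossing-⊆ {xs} {ys} xs⊆ys e = nonCrossing-complete xs λ x∈ y∈ → nonCrossing-sound ys e (xs⊆ys x∈) (xs⊆ys y∈)

nonCrossing-↭ : ∀ {xs ys} → xs ↭ ys → nonCrossing xs ≡ nonCrossing ys
nonCrossing-↭ xs↭ys = ⇔→≡ (mk⇔ (nonCrossing-⊆ (∈-resp-↭ (↭-sym xs↭ys))) (nonCrossing-⊆ (∈-resp-↭ xs↭ys)))

crossing⇒nonCrossing-false : ∀ xs {x y} → x ∈ xs → y ∈ xs → crosses x y ≡ true → nonCrossing xs ≡ false
crossing⇒nonCrossing-false xs x∈ y∈ x×y with nonCrossing xs in e
... | false = refl
... | true  with () ← trans (sym x×y) (nonCrossing-sound xs e x∈ y∈)

crosses-sym : ∀ x y → crosses x y ≡ crosses y x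
crosses-sym (a , b) (c , d) = ∨-comm ((a <ᵇ c) ∧ (c <ᵇ b) ∧ (b <ᵇ d)) ((c <ᵇ a) ∧ (a <ᵇ d) ∧ (d <ᵇ b))

nonCrossing-++ : ∀ xs ys → Compatible xs ys → nonCrossing (xs ++ ys) ≡ nonCrossing xs ∧ nonCrossing ys
nonCrossing-++ xs ys compat = ⇔→≡ (mk⇔ split join)
  where
  split : nonCrossing (xs ++ ys) ≡ true → nonCrossing xs ∧ nonCrossing ys ≡ true
  split e rewrite nonCrossing-⊆ {xs} {xs ++ ys} ∈-++⁺ˡ e = nonCrossing-⊆ {ys} {xs ++ ys} (∈-++⁺ʳ xs) e
  join : nonCrossing xs ∧ nonCrossing ys ≡ true → nonCrossing (xs ++ ys) ≡ true
  join e with nonCrossing xs in e₁ | nonCrossing ys in e₂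
  join refl | true | true = nonCrossing-complete (xs ++ ys) nc
    where
    nc : NonCrossing (xs ++ ys)
    nc {x} {y} x∈ y∈ with ∈-++⁻ xs x∈ | ∈-++⁻ xs y∈
    ... | inj₁ x∈xs | inj₁ y∈xs = nonCrossing-sound xs e₁ x∈xs y∈xs
    ... | inj₁ x∈xs | inj₂ y∈ys = compat x∈xs y∈ys
    ... | inj₂ x∈ys | inj₁ y∈xs = trans (crosses-sym x y) (compat y∈xs x∈ys)
    ... | inj₂ x∈ys | inj₂ y∈ys = nonCrossing-sound ys e₂ x∈ys y∈ys

countNC : List Chord → List Chord → ℕ
countNC xs C = count (λ s → nonCrossing (s ++ C)) (powerset xs)

powerset-⊆ : ∀ {A : Set} (xs : List A) {s} → s ∈ powerset xs → s ⊆ xs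
powerset-⊆ []       (here refl) ()
powerset-⊆ (x ∷ xs) s∈ with ∈-++⁻ (powerset xs) s∈
... | inj₁ s∈′ = there ∘ powerset-⊆ xs s∈′
... | inj₂ s∈′ with ∈-map⁻ (x ∷_) s∈′
...   | s′ , s′∈ , refl = λ { (here e) → here e ; (there y∈) → there (powerset-⊆ xs s′∈ y∈) }

countNC-∷ : ∀ x xs C → countNC (x ∷ xs) C ≡ countNC xs C + countNC xs (x ∷ C)
countNC-∷ x xs C = begin
  count p (powerset xs ++ map (x ∷_) (powerset xs))
    ≡⟨ count-++ p (powerset xs) _ ⟩
  countNC xs C + count p (map (x ∷_) (powerset xs))
    ≡⟨ cong (countNC xs C +_) (count-map p (x ∷_) (powerset xs)) ⟩
  countNC xs C + count (p ∘ (x ∷_)) (powerset xs)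
    ≡⟨ cong (countNC xs C +_) (count-cong (powerset xs) λ {s} _ → nonCrossing-↭ (↭-sym (shift x s C))) ⟩
  countNC xs C + countNC xs (x ∷ C) ∎
  where
  p = λ s → nonCrossing (s ++ C)

countNC-compatible : ∀ zs B C → Compatible B (zs ++ C) →
                     countNC zs (B ++ C) ≡ (if nonCrossing B then 1 else 0) * countNC zs C
countNC-compatible zs B C compat =
  trans (count-cong (powerset zs) separate) (count-∧ (nonCrossing B) _ (powerset zs))
  where
  separate : ∀ {s} → s ∈ powerset zs → nonCrossing (s ++ B ++ C) ≡ nonCrossing B ∧ nonCrossing (s ++ C)
  separate {s} s∈ = trans (nonCrossing-↭ (shifts s B)) (nonCrossing-++ B (s ++ C) λ d∈ y∈ → compat d∈ (sub y∈))
    where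
    sub : s ++ C ⊆ zs ++ C
    sub y∈ with ∈-++⁻ s y∈
    ... | inj₁ y∈s = ∈-++⁺ˡ (powerset-⊆ zs s∈ y∈s)
    ... | inj₂ y∈C = ∈-++⁺ʳ zs y∈C

countNC-dropCompatible : ∀ zs c C → Compatible [ c ] (zs ++ C) → nonCrossing [ c ] ≡ true →
                         countNC zs (c ∷ C) ≡ countNC zs C
countNC-dropCompatible zs c C compat c-nc = begin
  countNC zs ([ c ] ++ C)                                ≡⟨ countNC-compatible zs [ c ] C compat ⟩
  (if nonCrossing [ c ] then 1 else 0) * countNC zs C    ≡⟨ cong (λ b → (if b then 1 else 0) * countNC zs C) c-nc ⟩
  1 * countNC zs C                                       ≡⟨ *-identityˡ _ ⟩
  countNC zs C ∎

countNC-++ : ∀ ys zs B C → Compatible (ys ++ B) (zs ++ C) → countNC (ys ++ zs) (B ++ C) ≡ countNC ys B * countNC zs C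
countNC-++ []       zs B C compat = countNC-compatible zs B C compat
countNC-++ (y ∷ ys) zs B C compat = begin
  countNC (y ∷ ys ++ zs) (B ++ C)
    ≡⟨ countNC-∷ y (ys ++ zs) (B ++ C) ⟩
  countNC (ys ++ zs) (B ++ C) + countNC (ys ++ zs) ((y ∷ B) ++ C)
    ≡⟨ cong₂ _+_ (countNC-++ ys zs B C (compat ∘ there))
                 (countNC-++ ys zs (y ∷ B) C (compat ∘ ∈-resp-↭ (shift y ys B))) ⟩
  countNC ys B * countNC zs C + countNC ys (y ∷ B) * countNC zs C
    ≡⟨ sym (*-distribʳ-+ (countNC zs C) (countNC ys B) (countNC ys (y ∷ B))) ⟩
  (countNC ys B + countNC ys (y ∷ B)) * countNC zs C
    ≡⟨ cong (_* countNC zs C) (sym (countNC-∷ y ys B)) ⟩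
  countNC (y ∷ ys) B * countNC zs C ∎

countNC-factor : ∀ xs ys zs C → Compatible ys (xs ++ zs ++ C) →
                 countNC (xs ++ ys ++ zs) C ≡ countNC ys [] * countNC (xs ++ zs) C
countNC-factor []       ys zs C compat = countNC-++ ys zs [] C (compat ∘ ∈-resp-↭ (↭-++-identityʳ ys))
countNC-factor (x ∷ xs) ys zs C compat = begin
  countNC (x ∷ xs ++ ys ++ zs) C
    ≡⟨ countNC-∷ x (xs ++ ys ++ zs) C ⟩
  countNC (xs ++ ys ++ zs) C + countNC (xs ++ ys ++ zs) (x ∷ C)
    ≡⟨ cong₂ _+_ (countNC-factor xs ys zs C λ y∈ z∈ → compat y∈ (there z∈))
                 (countNC-factor xs ys zs (x ∷ C) λ y∈ z∈ → compat y∈ (∈-resp-↭ moved z∈)) ⟩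
  countNC ys [] * countNC (xs ++ zs) C + countNC ys [] * countNC (xs ++ zs) (x ∷ C)
    ≡⟨ sym (*-distribˡ-+ (countNC ys []) _ _) ⟩
  countNC ys [] * (countNC (xs ++ zs) C + countNC (xs ++ zs) (x ∷ C))
    ≡⟨ cong (countNC ys [] *_) (sym (countNC-∷ x (xs ++ zs) C)) ⟩
  countNC ys [] * countNC (x ∷ xs ++ zs) C ∎
  where
  moved : xs ++ zs ++ x ∷ C ↭ x ∷ xs ++ zs ++ C
  moved = ↭-trans (++⁺ˡ xs (shift x zs C)) (shift x xs (zs ++ C))

countNC-map : (g : Chord → Chord) → (∀ x y → crosses (g x) (g y) ≡ crosses x y) →
              ∀ xs C → countNC (map g xs) (map g C) ≡ countNC xs C
countNC-map g g-crosses xs C = begin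
  count p (powerset (map g xs))
    ≡⟨ cong (count p) (powerset-map xs) ⟩
  count p (map (map g) (powerset xs))
    ≡⟨ count-map p (map g) (powerset xs) ⟩
  count (p ∘ map g) (powerset xs)
    ≡⟨ count-cong (powerset xs) (λ {s} _ → trans (cong nonCrossing (sym (map-++ g s C))) (nonCrossing-map (s ++ C))) ⟩
  countNC xs C ∎
  where
  p = λ s → nonCrossing (s ++ map g C)
  allB-map : {A : Set} (q : Chord → Bool) (f : A → Chord) (ys : List A) → allB q (map f ys) ≡ allB (q ∘ f) ys
  allB-map q f []       = refl
  allB-map q f (y ∷ ys) = cong (q (f y) ∧_) (allB-map q f ys)
  allB-cong : {A : Set} {q r : A → Bool} (ys : List A) → (∀ y → q y ≡ r y) → allB q ys ≡ allB r ys
  allB-cong []       q≗r = refl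
  allB-cong (y ∷ ys) q≗r = cong₂ _∧_ (q≗r y) (allB-cong ys q≗r)
  nonCrossing-map : ∀ ys → nonCrossing (map g ys) ≡ nonCrossing ys
  nonCrossing-map ys = trans (allB-map _ g ys) (allB-cong ys λ x →
                         trans (allB-map _ g ys) (allB-cong ys λ y → cong not (g-crosses x y)))
  powerset-map : ∀ ys → powerset (map g ys) ≡ map (map g) (powerset ys)
  powerset-map []       = refl
  powerset-map (y ∷ ys) rewrite powerset-map ys =
    trans (cong (map (map g) (powerset ys) ++_) (trans (sym (map-∘ (powerset ys))) (map-∘ (powerset ys))))
          (sym (map-++ (map g) (powerset ys) (map (y ∷_) (powerset ys))))

data Prune (C : List Chord) : List Chord → List Chord → Set where
  []   : Prune C [] []
  keep : ∀ {x xs ys} → Prune C xs ys → Prune C (x ∷ xs) (x ∷ ys)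
  drop : ∀ {x xs ys c} → c ∈ C → crosses c x ≡ true → Prune C xs ys → Prune C (x ∷ xs) ys

Prune-++ : ∀ {C xs ys xs′ ys′} → Prune C xs ys → Prune C xs′ ys′ → Prune C (xs ++ xs′) (ys ++ ys′)
Prune-++ []              p′ = p′
Prune-++ (keep p)        p′ = keep (Prune-++ p p′)
Prune-++ (drop c∈ c×x p) p′ = drop c∈ c×x (Prune-++ p p′)

Prune-refl : ∀ {C} xs → Prune C xs xs
Prune-refl []       = []
Prune-refl (x ∷ xs) = keep (Prune-refl xs)

Prune-all : ∀ {c C} xs → (∀ {x} → x ∈ xs → crosses c x ≡ true) → Prune (c ∷ C) xs []
Prune-all []       c×  = []
Prune-all (x ∷ xs) c× = drop (here refl) (c× (here refl)) (Prune-all xs (c× ∘ there))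

countNC-crossed : ∀ xs x C {c} → c ∈ C → crosses c x ≡ true → countNC xs (x ∷ C) ≡ 0
countNC-crossed xs x C c∈ c×x =
  trans (count-cong (powerset xs) λ {s} _ →
           crossing⇒nonCrossing-false (s ++ x ∷ C) (∈-++⁺ʳ s (there c∈)) (∈-++⁺ʳ s (here refl)) c×x)
        (count-false (powerset xs))

countNC-Prune : ∀ {C₀ xs ys} → Prune C₀ xs ys → ∀ C → C₀ ⊆ C → countNC xs C ≡ countNC ys C
countNC-Prune [] C _ = refl
countNC-Prune (keep {x} {xs} {ys} p) C C₀⊆C = begin
  countNC (x ∷ xs) C                ≡⟨ countNC-∷ x xs C ⟩
  countNC xs C + countNC xs (x ∷ C) ≡⟨ cong₂ _+_ (countNC-Prune p C C₀⊆C) (countNC-Prune p (x ∷ C) (there ∘ C₀⊆C)) ⟩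
  countNC ys C + countNC ys (x ∷ C) ≡⟨ sym (countNC-∷ x ys C) ⟩
  countNC (x ∷ ys) C ∎
countNC-Prune (drop {x} {xs} {ys} c∈ c×x p) C C₀⊆C = begin
  countNC (x ∷ xs) C                ≡⟨ countNC-∷ x xs C ⟩
  countNC xs C + countNC xs (x ∷ C) ≡⟨ cong₂ _+_ (countNC-Prune p C C₀⊆C) (countNC-crossed xs x C (C₀⊆C c∈) c×x) ⟩
  countNC ys C + 0                  ≡⟨ +-identityʳ _ ⟩
  countNC ys C ∎

interval : ℕ → ℕ → List ℕ
interval a zero    = []
interval a (suc n) = a ∷ interval (suc a) n

row : ℕ → List ℕ → List Chord
row i = map (i ,_)

-- All chords of the polygon with vertices x, …, x + m, its side (x , x + m) included.
chords : ℕ → ℕ → List Chord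
chords x zero    = []
chords x (suc m) = row x (interval (2 + x) m) ++ chords (suc x) m

-- The rows of chords x (m + t) that start at one of the first m vertices.
initialRows : ℕ → ℕ → ℕ → List Chord
initialRows x zero    t = []
initialRows x (suc m) t = row x (interval (2 + x) (m + t)) ++ initialRows (suc x) m t

-- The diagonals of the polygon with vertices 0, …, m + 1.
polygonDiagonals : ℕ → List Chord
polygonDiagonals m = row 0 (interval 2 (pred m)) ++ chords 1 m

interval-++ : ∀ a m n → interval a (m + n) ≡ interval a m ++ interval (a + m) n
interval-++ a zero    n = cong (λ b → interval b n) (sym (+-identityʳ a))
interval-++ a (suc m) n =
  cong (a ∷_) (trans (interval-++ (suc a) m n) (cong (λ b → interval (suc a) m ++ interval b n) (sym (+-suc a m))))

interval-suc : ∀ a m → interval a (suc m) ≡ interval a m ++ [ a + m ]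
interval-suc a m = trans (cong (interval a) (+-comm 1 m)) (interval-++ a m 1)

chords-++ : ∀ x m t → chords x (m + t) ≡ initialRows x m t ++ chords (x + m) t
chords-++ x zero    t = cong (λ y → chords y t) (sym (+-identityʳ x))
chords-++ x (suc m) t = begin
  row x (interval (2 + x) (m + t)) ++ chords (suc x) (m + t)
    ≡⟨ cong (row x (interval (2 + x) (m + t)) ++_) (chords-++ (suc x) m t) ⟩
  row x (interval (2 + x) (m + t)) ++ (initialRows (suc x) m t ++ chords (suc x + m) t)
    ≡⟨ sym (++-assoc (row x (interval (2 + x) (m + t))) _ _) ⟩
  initialRows x (suc m) t ++ chords (suc x + m) t
    ≡⟨ cong (λ y → initialRows x (suc m) t ++ chords y t) (sym (+-suc x m)) ⟩
  initialRows x (suc m) t ++ chords (x + suc m) t ∎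

∈-interval : ∀ {j} a n → j ∈ interval a n → a ≤ j × j < a + n
∈-interval a (suc n) (here refl) = ≤-refl , m<m+n a z<s
∈-interval a (suc n) (there j∈) with ∈-interval (suc a) n j∈
... | a<j , j<a+n = <⇒≤ a<j , ≤-trans j<a+n (≤-reflexive (sym (+-suc a n)))

∈-row : ∀ {i′ j} i js → (i′ , j) ∈ row i js → i′ ≡ i × j ∈ js
∈-row i js ij∈ with ∈-map⁻ (i ,_) ij∈
... | j , j∈ , refl = refl , j∈

∈-chords : ∀ {i j} x m → (i , j) ∈ chords x m → x ≤ i × 2 + i ≤ j × j ≤ x + m
∈-chords x (suc m) ij∈ with ∈-++⁻ (row x (interval (2 + x) m)) ij∈
... | inj₁ ij∈row with ∈-row x _ ij∈row
...   | refl , j∈ with ∈-interval (2 + x) m j∈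
...     | 2+x≤j , j<2+x+m = ≤-refl , 2+x≤j , ≤-trans (≤-pred j<2+x+m) (≤-reflexive (sym (+-suc x m)))
∈-chords x (suc m) ij∈ | inj₂ ij∈rest with ∈-chords (suc x) m ij∈rest
... | x<i , 2+i≤j , j≤ = <⇒≤ x<i , 2+i≤j , ≤-trans j≤ (≤-reflexive (sym (+-suc x m)))

<⇒<ᵇ≡true : ∀ {m n} → m < n → (m <ᵇ n) ≡ true
<⇒<ᵇ≡true m<n = Equivalence.to T-≡ (<⇒<ᵇ m<n)

≤⇒<ᵇ≡false : ∀ {m n} → n ≤ m → (m <ᵇ n) ≡ false
≤⇒<ᵇ≡false {m} {n} n≤m with m <ᵇ n in eq
... | false = refl
... | true  with () ← <⇒≱ (<ᵇ⇒< m n (Equivalence.from T-≡ eq)) n≤m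

∧₃-false : ∀ {x y z} → (T x → T y → T z → ⊥) → x ∧ y ∧ z ≡ false
∧₃-false {false}               _ = refl
∧₃-false {true} {false}        _ = refl
∧₃-false {true} {true} {false} _ = refl
∧₃-false {true} {true} {true}  h = ⊥-elim (h _ _ _)

crosses-false : ∀ a b c d → (a < c → c < b → b < d → ⊥) → (c < a → a < d → d < b → ⊥) →
                crosses (a , b) (c , d) ≡ false
crosses-false a b c d h₁ h₂
  rewrite ∧₃-false {a <ᵇ c} {c <ᵇ b} {b <ᵇ d} (λ p q r → h₁ (<ᵇ⇒< a c p) (<ᵇ⇒< c b q) (<ᵇ⇒< b d r))
        | ∧₃-false {c <ᵇ a} {a <ᵇ d} {d <ᵇ b} (λ p q r → h₂ (<ᵇ⇒< c a p) (<ᵇ⇒< a d q) (<ᵇ⇒< d b r)) = refl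

crosses-true : ∀ {a b c d} → a < c → c < b → b < d → crosses (a , b) (c , d) ≡ true
crosses-true a<c c<b b<d rewrite <⇒<ᵇ≡true a<c | <⇒<ᵇ≡true c<b | <⇒<ᵇ≡true b<d = refl

onChord : (ℕ → ℕ) → Chord → Chord
onChord f (i , j) = f i , f j

-- Fixes 0 when z = 0; translation by one when z = c = 1.
relabel : ℕ → ℕ → ℕ → ℕ
relabel z c zero    = z
relabel z c (suc t) = suc t + c

+-<ᵇ : ∀ c a b → (a + c <ᵇ b + c) ≡ (a <ᵇ b)
+-<ᵇ c a b rewrite +-comm a c | +-comm b c = go c
  where
  go : ∀ c → (c + a <ᵇ c + b) ≡ (a <ᵇ b)
  go zero    = refl
  go (suc c) = go c

relabel-<ᵇ : ∀ {z c} → z ≤ c → ∀ a b → (relabel z c a <ᵇ relabel z c b) ≡ (a <ᵇ b)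
relabel-<ᵇ {z} z≤c zero    zero    = ≤⇒<ᵇ≡false (≤-refl {z})
relabel-<ᵇ z≤c zero    (suc b) = <⇒<ᵇ≡true (s≤s (≤-trans z≤c (m≤n+m _ b)))
relabel-<ᵇ z≤c (suc a) zero    = ≤⇒<ᵇ≡false (≤-trans z≤c (m≤n+m _ (suc a)))
relabel-<ᵇ z≤c (suc a) (suc b) = +-<ᵇ _ (suc a) (suc b)

relabel-crosses : ∀ {z c} → z ≤ c → ∀ x y → crosses (onChord (relabel z c) x) (onChord (relabel z c) y) ≡ crosses x y
relabel-crosses z≤c (a , b) (c , d)
  rewrite relabel-<ᵇ z≤c a c | relabel-<ᵇ z≤c c b | relabel-<ᵇ z≤c b d
        | relabel-<ᵇ z≤c c a | relabel-<ᵇ z≤c a d | relabel-<ᵇ z≤c d b = refl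

row-map : ∀ f i js → map (onChord f) (row i js) ≡ row (f i) (map f js)
row-map f i []       = refl
row-map f i (j ∷ js) = cong (_ ∷_) (row-map f i js)

relabel-interval : ∀ z c a n → map (relabel z c) (interval (suc a) n) ≡ interval (suc a + c) n
relabel-interval z c a zero    = refl
relabel-interval z c a (suc n) = cong (_ ∷_) (relabel-interval z c (suc a) n)

relabel-row : ∀ z c i a n →
              map (onChord (relabel z c)) (row i (interval (suc a) n)) ≡ row (relabel z c i) (interval (suc a + c) n)
relabel-row z c i a n = trans (row-map (relabel z c) i _) (cong (row (relabel z c i)) (relabel-interval z c a n))

relabel-chords : ∀ z c x m → map (onChord (relabel z c)) (chords (suc x) m) ≡ chords (suc x + c) m
relabel-chords z c x zero    = refl
relabel-chords z c x (suc m) = begin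
  map (onChord (relabel z c)) (row (suc x) (interval (2 + suc x) m) ++ chords (suc (suc x)) m)
    ≡⟨ map-++ (onChord (relabel z c)) (row (suc x) (interval (2 + suc x) m)) _ ⟩
  map (onChord (relabel z c)) (row (suc x) (interval (2 + suc x) m)) ++ map (onChord (relabel z c)) (chords (suc (suc x)) m)
    ≡⟨ cong₂ _++_ (relabel-row z c (suc x) (2 + x) m) (relabel-chords z c (suc x) m) ⟩
  chords (suc x + c) (suc m) ∎

-- Recurrences for the dissection counts

dissectionCount chordSetCount : ℕ → ℕ
dissectionCount m = countNC (polygonDiagonals m) []
chordSetCount p = countNC (chords 0 p) []

countNC-chords-shift : ∀ p → countNC (chords 1 p) [] ≡ chordSetCount p
countNC-chords-shift zero    = refl
countNC-chords-shift (suc m) =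
  trans (cong (λ xs → countNC xs []) (sym image))
        (countNC-map (onChord (relabel 1 1)) (relabel-crosses ≤-refl) (chords 0 (suc m)) [])
  where
  image : map (onChord (relabel 1 1)) (chords 0 (suc m)) ≡ chords 1 (suc m)
  image = trans (map-++ (onChord (relabel 1 1)) (row 0 (interval 2 m)) (chords 1 m))
                (cong₂ _++_ (relabel-row 1 1 0 1 m) (relabel-chords 1 1 0 m))

countNC-polygon-shift : ∀ u r → countNC (row 0 (interval (3 + u) r) ++ chords (2 + u) (suc r)) [] ≡ dissectionCount (suc r)
countNC-polygon-shift u r =
  trans (cong (λ xs → countNC xs []) (sym image))
        (countNC-map (onChord (relabel 0 (suc u))) (relabel-crosses z≤n) (polygonDiagonals (suc r)) [])
  where
  image : map (onChord (relabel 0 (suc u))) (polygonDiagonals (suc r)) ≡ row 0 (interval (3 + u) r) ++ chords (2 + u) (suc r)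
  image = trans (map-++ (onChord (relabel 0 (suc u))) (row 0 (interval 2 r)) (chords 1 (suc r)))
                (cong₂ _++_ (relabel-row 0 (suc u) 0 1 r) (relabel-chords 0 (suc u) 0 (suc r)))

-- The diagonal (0 , x + 1 + m) crosses those chords of initialRows that reach beyond x + 1 + m.
initialRows-Prune : ∀ x m t → Prune [ (0 , suc x + m) ] (initialRows (suc x) m t) (chords (suc x) m)
initialRows-Prune x zero    t = []
initialRows-Prune x (suc m) t =
  subst (λ xs → Prune [ (0 , suc x + suc m) ] xs (inner ++ chords (suc (suc x)) m)) (sym split)
    (Prune-++ (Prune-refl inner)
      (Prune-++ (Prune-all (row (suc x) (interval (2 + suc x + m) t)) crossed)
                (subst (λ k → Prune [ (0 , k) ] (initialRows (suc (suc x)) m t) (chords (suc (suc x)) m))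
                       (sym (+-suc (suc x) m)) (initialRows-Prune (suc x) m t))))
  where
  inner = row (suc x) (interval (2 + suc x) m)
  split : initialRows (suc x) (suc m) t ≡ inner ++ row (suc x) (interval (2 + suc x + m) t) ++ initialRows (suc (suc x)) m t
  split = trans (cong (_++ initialRows (suc (suc x)) m t)
                      (trans (cong (row (suc x)) (interval-++ (2 + suc x) m t)) (map-++ _ (interval (2 + suc x) m) _)))
                (++-assoc inner _ _)
  crossed : ∀ {z} → z ∈ row (suc x) (interval (2 + suc x + m) t) → crosses (0 , suc x + suc m) z ≡ true
  crossed {i , j} z∈ with ∈-row (suc x) _ z∈
  ... | refl , j∈ with ∈-interval (2 + suc x + m) t j∈
  ...   | beyond , _ = crosses-true z<s (m<m+n (suc x) z<s) (≤-trans (s≤s (≤-reflexive (+-suc (suc x) m))) beyond)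

Compatible-++ : ∀ {xs} ys {zs} → Compatible xs ys → Compatible xs zs → Compatible xs (ys ++ zs)
Compatible-++ ys c₁ c₂ x∈ y∈ with ∈-++⁻ ys y∈
... | inj₁ y∈ys = c₁ x∈ y∈ys
... | inj₂ y∈zs = c₂ x∈ y∈zs

Compatible-[] : ∀ {xs} → Compatible xs []
Compatible-[] _ ()

-- Inside the polygon 1, …, u + 2 cut off by the diagonal (0 , u + 2).
inside-compatible : ∀ u r →
  Compatible (chords 1 (suc u)) (row 0 (interval (3 + u) r) ++ chords (2 + u) (suc r) ++ [ (0 , 2 + u) ])
inside-compatible u r = Compatible-++ (row 0 (interval (3 + u) r)) fan (Compatible-++ (chords (2 + u) (suc r)) outside cut)
  where
  fan : Compatible (chords 1 (suc u)) (row 0 (interval (3 + u) r))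
  fan {i , j} {i′ , j′} ij∈ i′j′∈ with ∈-chords 1 (suc u) ij∈ | ∈-row 0 _ i′j′∈
  ... | _ , _ , j≤ | refl , j′∈ with ∈-interval (3 + u) r j′∈
  ...   | j′≥ , _ = crosses-false i j 0 j′ (λ ()) (λ _ _ j′<j → <⇒≱ (≤-trans j′<j j≤) (<⇒≤ j′≥))
  outside : Compatible (chords 1 (suc u)) (chords (2 + u) (suc r))
  outside {i , j} {i′ , j′} ij∈ i′j′∈ with ∈-chords 1 (suc u) ij∈ | ∈-chords (2 + u) (suc r) i′j′∈
  ... | _ , 2+i≤j , j≤ | i′≥ , _ , _ =
    crosses-false i j i′ j′ (λ _ i′<j _ → <⇒≱ (≤-trans i′<j j≤) i′≥)
                  (λ i′<i _ _ → <⇒≱ (≤-trans i′<i (≤-trans (m≤n+m i 2) (≤-trans 2+i≤j j≤))) i′≥)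
  cut : Compatible (chords 1 (suc u)) [ (0 , 2 + u) ]
  cut {i , j} ij∈ (here refl) with ∈-chords 1 (suc u) ij∈
  ... | _ , _ , j≤ = crosses-false i j 0 (2 + u) (λ ()) (λ _ _ 2+u<j → <⇒≱ 2+u<j j≤)

cut-compatible : ∀ u r → Compatible [ (0 , 2 + u) ] ((row 0 (interval (3 + u) r) ++ chords (2 + u) (suc r)) ++ [])
cut-compatible u r =
  Compatible-++ (row 0 (interval (3 + u) r) ++ chords (2 + u) (suc r))
                (Compatible-++ (row 0 (interval (3 + u) r)) fan outside) Compatible-[]
  where
  fan : Compatible [ (0 , 2 + u) ] (row 0 (interval (3 + u) r))
  fan (here refl) i′j′∈ with ∈-row 0 _ i′j′∈
  ... | refl , _ = refl
  outside : Compatible [ (0 , 2 + u) ] (chords (2 + u) (suc r))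
  outside {_} {i′ , j′} (here refl) i′j′∈ with ∈-chords (2 + u) (suc r) i′j′∈
  ... | i′≥ , _ , _ = crosses-false 0 (2 + u) i′ j′ (λ _ i′<2+u _ → <⇒≱ i′<2+u i′≥) (λ ())

-- Choosing the diagonal (0 , u + 2) cuts the polygon in two.
countNC-cut : ∀ u r → countNC (row 0 (interval (3 + u) r) ++ chords 1 (suc u + suc r)) [ (0 , 2 + u) ] ≡
                      chordSetCount (suc u) * dissectionCount (suc r)
countNC-cut u r = begin
  countNC (xs ++ chords 1 (suc u + suc r)) C
    ≡⟨ cong (λ ys → countNC (xs ++ ys) C) (chords-++ 1 (suc u) (suc r)) ⟩
  countNC (xs ++ initialRows 1 (suc u) (suc r) ++ zs) C
    ≡⟨ countNC-Prune pruned C (λ c∈ → c∈) ⟩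
  countNC (xs ++ chords 1 (suc u) ++ zs) C
    ≡⟨ countNC-factor xs (chords 1 (suc u)) zs C (inside-compatible u r) ⟩
  countNC (chords 1 (suc u)) [] * countNC (xs ++ zs) C
    ≡⟨ cong₂ _*_ (countNC-chords-shift (suc u)) (countNC-dropCompatible (xs ++ zs) (0 , 2 + u) [] (cut-compatible u r) refl) ⟩
  chordSetCount (suc u) * countNC (xs ++ zs) []
    ≡⟨ cong (chordSetCount (suc u) *_) (countNC-polygon-shift u r) ⟩
  chordSetCount (suc u) * dissectionCount (suc r) ∎
  where
  xs = row 0 (interval (3 + u) r)
  zs = chords (2 + u) (suc r)
  C  = [ (0 , 2 + u) ]
  pruned : Prune C (xs ++ initialRows 1 (suc u) (suc r) ++ zs) (xs ++ chords 1 (suc u) ++ zs)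
  pruned = Prune-++ (Prune-refl xs) (Prune-++ (initialRows-Prune 0 (suc u) (suc r)) (Prune-refl zs))

-- Sorting by the first diagonal (0 , u + 2) that is chosen.
countNC-fan : ∀ r u → countNC (row 0 (interval (2 + u) r) ++ chords 1 (suc u + r)) [] ≡
                      conv (λ t → chordSetCount (suc u + t)) dissectionCount r
countNC-fan zero    u = trans (countNC-chords-shift (suc u + 0)) (sym (*-identityʳ _))
countNC-fan (suc r) u = begin
  countNC ((0 , 2 + u) ∷ rest) []
    ≡⟨ countNC-∷ (0 , 2 + u) rest [] ⟩
  countNC rest [] + countNC rest [ (0 , 2 + u) ]
    ≡⟨ cong₂ _+_ (trans (cong (λ k → countNC (row 0 (interval (3 + u) r) ++ chords 1 k) []) (+-suc (suc u) r))
                        (countNC-fan r (suc u)))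
                 (countNC-cut u r) ⟩
  conv (λ t → chordSetCount (suc (suc u) + t)) dissectionCount r + chordSetCount (suc u) * dissectionCount (suc r)
    ≡⟨ +-comm _ (chordSetCount (suc u) * dissectionCount (suc r)) ⟩
  chordSetCount (suc u) * dissectionCount (suc r) + conv (λ t → chordSetCount (suc (suc u) + t)) dissectionCount r
    ≡⟨ cong₂ _+_ (cong (λ k → chordSetCount k * dissectionCount (suc r)) (sym (+-identityʳ (suc u))))
                 (conv-cong r (λ t _ → cong chordSetCount (sym (+-suc (suc u) t))) (λ _ _ → refl)) ⟩
  chordSetCount (suc u + 0) * dissectionCount (suc r) + conv (λ t → chordSetCount (suc u + suc t)) dissectionCount r ∎
  where
  rest = row 0 (interval (3 + u) r) ++ chords 1 (suc u + suc r)

dissectionCount-suc : ∀ m → dissectionCount (suc m) ≡ conv (chordSetCount ∘ suc) dissectionCount m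
dissectionCount-suc m = countNC-fan m 0

chordSetCount-suc-suc : ∀ q → chordSetCount (suc (suc q)) ≡ 2 * dissectionCount (suc q)
chordSetCount-suc-suc q = begin
  countNC (row 0 (interval 2 (suc q)) ++ chords 1 (suc q)) []
    ≡⟨ cong (λ xs → countNC (xs ++ chords 1 (suc q)) []) (trans (cong (row 0) (interval-suc 2 q)) (map-++ _ (interval 2 q) _)) ⟩
  countNC ((row 0 (interval 2 q) ++ [ side ]) ++ chords 1 (suc q)) []
    ≡⟨ cong (λ xs → countNC xs []) (++-assoc (row 0 (interval 2 q)) _ _) ⟩
  countNC (row 0 (interval 2 q) ++ [ side ] ++ chords 1 (suc q)) []
    ≡⟨ countNC-factor (row 0 (interval 2 q)) [ side ] (chords 1 (suc q)) [] compatible ⟩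
  2 * countNC (row 0 (interval 2 q) ++ chords 1 (suc q)) [] ∎
  where
  side = (0 , 2 + q)
  compatible : Compatible [ side ] (row 0 (interval 2 q) ++ chords 1 (suc q) ++ [])
  compatible = Compatible-++ (row 0 (interval 2 q)) fromZero (Compatible-++ (chords 1 (suc q)) inside Compatible-[])
    where
    fromZero : Compatible [ side ] (row 0 (interval 2 q))
    fromZero (here refl) i′j′∈ with ∈-row 0 _ i′j′∈
    ... | refl , _ = refl
    inside : Compatible [ side ] (chords 1 (suc q))
    inside {_} {i′ , j′} (here refl) i′j′∈ with ∈-chords 1 (suc q) i′j′∈
    ... | _ , _ , j′≤ = crosses-false 0 (2 + q) i′ j′ (λ _ _ 2+q<j′ → <⇒≱ 2+q<j′ j′≤) (λ ())

chordSetCount+ε≡2*dissectionCount : ∀ t → chordSetCount (suc t) + ε t ≡ 2 * dissectionCount t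
chordSetCount+ε≡2*dissectionCount zero    = refl
chordSetCount+ε≡2*dissectionCount (suc q) = trans (+-identityʳ _) (chordSetCount-suc-suc q)

diagonal? : ∀ n → Decidable (λ p → T (isDiagonal n p))
diagonal? n p = T? (isDiagonal n p)

range≡interval : ∀ m → range m ≡ interval 0 m
range≡interval zero    = refl
range≡interval (suc m) = trans (cong (_++ [ m ]) (range≡interval m)) (sym (interval-suc 0 m))

isDiagonal-suc : ∀ n x j → isDiagonal n (suc x , j) ≡ (2 + x <ᵇ j)
isDiagonal-suc n x j = ∧-identityʳ (2 + x <ᵇ j)

<⇒≡ᵇ≡false : ∀ {m n} → m < n → (m ≡ᵇ n) ≡ false
<⇒≡ᵇ≡false {m} {n} m<n with m ≡ᵇ n in eq
... | false = refl
... | true  with () ← <-irrefl (≡ᵇ⇒≡ m n (Equivalence.from T-≡ eq)) m<n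

filter-row-zero : ∀ n → filter (diagonal? n) (row 0 (interval 0 (2 + n))) ≡ row 0 (interval 2 (pred n))
filter-row-zero zero    = refl
filter-row-zero (suc n) = begin
  filter (diagonal? (suc n)) (row 0 (interval 2 (suc n)))
    ≡⟨ cong (filter (diagonal? (suc n))) (trans (cong (row 0) (interval-suc 2 n)) (map-++ _ (interval 2 n) _)) ⟩
  filter (diagonal? (suc n)) (row 0 (interval 2 n) ++ [ (0 , 2 + n) ])
    ≡⟨ filter-++ (diagonal? (suc n)) (row 0 (interval 2 n)) _ ⟩
  filter (diagonal? (suc n)) (row 0 (interval 2 n)) ++ filter (diagonal? (suc n)) [ (0 , 2 + n) ]
    ≡⟨ cong₂ _++_ (filter-all (diagonal? (suc n)) (tabulate inner)) side ⟩
  row 0 (interval 2 n) ++ []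
    ≡⟨ ++-identityʳ _ ⟩
  row 0 (interval 2 n) ∎
  where
  inner : ∀ {z} → z ∈ row 0 (interval 2 n) → T (isDiagonal (suc n) z)
  inner {i , j} z∈ with ∈-row 0 _ z∈
  ... | refl , j∈ with ∈-interval 2 n j∈
  ...   | 2≤j , j<2+n rewrite <⇒<ᵇ≡true 2≤j | <⇒≡ᵇ≡false j<2+n = _
  side : filter (diagonal? (suc n)) [ (0 , 2 + n) ] ≡ []
  side rewrite Equivalence.to T-≡ (≡⇒≡ᵇ n n refl) = refl

filter-row-suc : ∀ n x m → suc x + suc m ≡ suc n →
                 filter (diagonal? n) (row (suc x) (interval 0 (2 + n))) ≡ row (suc x) (interval (3 + x) m)
filter-row-suc n x m eq = begin
  filter (diagonal? n) (row (suc x) (interval 0 (2 + n)))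
    ≡⟨ cong (filter (diagonal? n) ∘ row (suc x)) (trans (cong (interval 0) length≡) (interval-++ 0 (3 + x) m)) ⟩
  filter (diagonal? n) (row (suc x) (interval 0 (3 + x) ++ interval (3 + x) m))
    ≡⟨ cong (filter (diagonal? n)) (map-++ (suc x ,_) (interval 0 (3 + x)) _) ⟩
  filter (diagonal? n) (row (suc x) (interval 0 (3 + x)) ++ row (suc x) (interval (3 + x) m))
    ≡⟨ filter-++ (diagonal? n) (row (suc x) (interval 0 (3 + x))) _ ⟩
  filter (diagonal? n) (row (suc x) (interval 0 (3 + x))) ++ filter (diagonal? n) (row (suc x) (interval (3 + x) m))
    ≡⟨ cong₂ _++_ (filter-none (diagonal? n) (tabulate tooShort)) (filter-all (diagonal? n) (tabulate long)) ⟩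
  row (suc x) (interval (3 + x) m) ∎
  where
  length≡ : 2 + n ≡ (3 + x) + m
  length≡ = cong suc (trans (sym eq) (+-suc (suc x) m))
  tooShort : ∀ {z} → z ∈ row (suc x) (interval 0 (3 + x)) → ¬ T (isDiagonal n z)
  tooShort {i , j} z∈ with ∈-row (suc x) _ z∈
  ... | refl , j∈ rewrite isDiagonal-suc n x j | ≤⇒<ᵇ≡false (≤-pred (proj₂ (∈-interval 0 (3 + x) j∈))) = λ ()
  long : ∀ {z} → z ∈ row (suc x) (interval (3 + x) m) → T (isDiagonal n z)
  long {i , j} z∈ with ∈-row (suc x) _ z∈
  ... | refl , j∈ rewrite isDiagonal-suc n x j | <⇒<ᵇ≡true (proj₁ (∈-interval (3 + x) m j∈)) = _

filter-row-last : ∀ n → filter (diagonal? n) (row (suc n) (interval 0 (2 + n))) ≡ []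
filter-row-last n = filter-none (diagonal? n) (tabulate tooShort)
  where
  tooShort : ∀ {z} → z ∈ row (suc n) (interval 0 (2 + n)) → ¬ T (isDiagonal n z)
  tooShort {i , j} z∈ with ∈-row (suc n) _ z∈
  ... | refl , j∈ rewrite isDiagonal-suc n n j
                        | ≤⇒<ᵇ≡false (≤-trans (≤-pred (proj₂ (∈-interval 0 (2 + n) j∈))) (n≤1+n _)) = λ ()

rows : ℕ → List ℕ → List Chord
rows n = concatMap' (λ i → row i (interval 0 (2 + n)))

filter-rows : ∀ n x m → suc x + m ≡ suc n → filter (diagonal? n) (rows n (interval (suc x) (suc m))) ≡ chords (suc x) m
filter-rows n x zero    eq = begin
  filter (diagonal? n) (row (suc x) (interval 0 (2 + n)) ++ [])
    ≡⟨ cong (filter (diagonal? n)) (++-identityʳ (row (suc x) (interval 0 (2 + n)))) ⟩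
  filter (diagonal? n) (row (suc x) (interval 0 (2 + n)))
    ≡⟨ cong (λ y → filter (diagonal? n) (row y (interval 0 (2 + n)))) (trans (sym (+-identityʳ (suc x))) eq) ⟩
  filter (diagonal? n) (row (suc n) (interval 0 (2 + n)))
    ≡⟨ filter-row-last n ⟩
  [] ∎
filter-rows n x (suc m) eq =
  trans (filter-++ (diagonal? n) (row (suc x) (interval 0 (2 + n))) _)
        (cong₂ _++_ (filter-row-suc n x m eq) (filter-rows n (suc x) m (trans (sym (+-suc (suc x) m)) eq)))

diagonals≡polygonDiagonals : ∀ n → diagonals n ≡ polygonDiagonals n
diagonals≡polygonDiagonals n = begin
  filter (diagonal? n) (concatMap' (λ i → map (i ,_) (range (2 + n))) (range (2 + n)))
    ≡⟨ cong (λ r → filter (diagonal? n) (concatMap' (λ i → map (i ,_) r) r)) (range≡interval (2 + n)) ⟩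
  filter (diagonal? n) (row 0 (interval 0 (2 + n)) ++ rows n (interval 1 (suc n)))
    ≡⟨ filter-++ (diagonal? n) (row 0 (interval 0 (2 + n))) _ ⟩
  filter (diagonal? n) (row 0 (interval 0 (2 + n))) ++ filter (diagonal? n) (rows n (interval 1 (suc n)))
    ≡⟨ cong₂ _++_ (filter-row-zero n) (filter-rows n 0 n refl) ⟩
  polygonDiagonals n ∎

dissectionCount≡little : ∀ n → dissectionCount n ≡ little (double n)
dissectionCount≡little = <-rec _ λ n ih → step n (λ m → ih {m})
  where
  chordSetCount≡large : ∀ t → dissectionCount t ≡ little (double t) → chordSetCount (suc t) ≡ large (double t)
  chordSetCount≡large t eq = +-cancelʳ-≡ (ε t) _ _ (begin
    chordSetCount (suc t) + ε t     ≡⟨ chordSetCount+ε≡2*dissectionCount t ⟩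
    2 * dissectionCount t           ≡⟨ cong (2 *_) eq ⟩
    2 * little (double t)           ≡⟨ sym (large+ε≡2*little (double t)) ⟩
    large (double t) + ε (double t) ≡⟨ cong (large (double t) +_) (ε-double t) ⟩
    large (double t) + ε t ∎)
  step : ∀ n → (∀ m → m < n → dissectionCount m ≡ little (double m)) → dissectionCount n ≡ little (double n)
  step zero    ih = refl
  step (suc n) ih = begin
    dissectionCount (suc n)
      ≡⟨ dissectionCount-suc n ⟩
    conv (chordSetCount ∘ suc) dissectionCount n
      ≡⟨ conv-cong n (λ t t≤n → chordSetCount≡large t (ih t (s≤s t≤n))) (λ t t≤n → ih t (s≤s t≤n)) ⟩
    conv (large ∘ double) (little ∘ double) n
      ≡⟨ sym (conv-double n large little large-odd) ⟩
    conv large little (double n)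
      ≡⟨ sym (little-suc-suc (double n)) ⟩
    little (double (suc n)) ∎

littleSchroder≡little : ∀ n → littleSchroder n ≡ little (2 * n)
littleSchroder≡little n = begin
  length (dissections n)
    ≡⟨ length-filter≡count nonCrossing (powerset (diagonals n)) ⟩
  count nonCrossing (powerset (diagonals n))
    ≡⟨ count-cong (powerset (diagonals n)) (λ {s} _ → cong nonCrossing (sym (++-identityʳ s))) ⟩
  countNC (diagonals n) []
    ≡⟨ cong (λ xs → countNC xs []) (diagonals≡polygonDiagonals n) ⟩
  dissectionCount n
    ≡⟨ dissectionCount≡little n ⟩
  little (double n)
    ≡⟨ cong little (sym (2*≡double n)) ⟩
  little (2 * n) ∎

decoratedDyck≡little : ∀ w → decoratedDyck 0 0 w ≡ little w
decoratedDyck≡little w = trans (proj₁ (decoratedDyck≡weightedDyck w 0)) (proj₁ (weightedDyck≡schröder w))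

mainTheorem4 : (n : ℕ) → (DF n ↔ LS n) × (DF n ↔ Fin (littleSchroder n)) × (LS n ↔ Fin (littleSchroder n))
mainTheorem4 n = ↔-trans DF↔sₙ (↔-sym LS↔sₙ) , DF↔sₙ , LS↔sₙ
  where
  LS↔sₙ : LS n ↔ Fin (littleSchroder n)
  LS↔sₙ = ↔-trans (LS↔Fin n) (Fin-cong (sym (littleSchroder≡little n)))
  DF↔sₙ : DF n ↔ Fin (littleSchroder n)
  DF↔sₙ = ↔-trans (DF↔Fin n) (Fin-cong (trans (decoratedDyck≡little (2 * n)) (sym (littleSchroder≡little n))))
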